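{- Let $q$ be a prime power and let $G=\mathrm{PGL}(2,q)$ in its natural $2$-transitive action on the $q+1$ points of the projective line. Then $\mathbf{d}_G=(q-1)q/2$, and for every inverse-closed $D\subseteq\mathrm{Der}(G)$ having fewer than $(q-1)q/2$ labels, $\alpha(\mathrm{Cay}(G,\mathrm{Der}(G)\setminus D))=\alpha(\Gamma_G)=|G|/(q+1)$. Thus $G$ is EKR robust.
   Context: For a finite transitive permutation group $G$ of degree $m$ acting on a set $\Omega$: a derangement is an element with no fixed point; $\mathrm{Der}(G)$ is the set of derangements. For inverse-closed $S\subseteq G$ not containing the identity, $\mathrm{Cay}(G,S)$ has vertex set $G$, with $g,h$ adjacent iff $g^{ -1}h\in S$. $\Gamma_G=\mathrm{Cay}(G,\mathrm{Der}(G))$; $\alpha$ is the independence number. A label is a set $\{d,d^{ -1}\}$ with $d\in \mathrm{Der}(G)$; the number of labels of $D\subseteq\mathrm{Der}(G)$ is $|\{\{d,d^{ -1}\}:d\in D\}|$. For $i\neq j$, $D_{i\to j}=\{d\in\mathrm{Der}(G): d(i)=j\}$ and $\mathbf{d}_G=\min_{i\ne j}|\{\{d,d^{ -1}\}:d\in D_{i\to j}\}|$. $G$ is EKR robust if $\alpha(\mathrm{Cay}(G,\mathrm{Der}(G)\setminus D))=|G|/m$ for every inverse-closed $D\subseteq\mathrm{Der}(G)$ with fewer than $\mathbf{d}_G$ labels. -}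

module Defs where

open import Level using (0ℓ)
open import Data.Nat using (ℕ; _<_; _≤_)
import Data.Nat as N
open import Data.Unit using (⊤)
open import Data.Fin using (Fin)
open import Data.List using (List; length)
open import Data.List.Relation.Unary.All using (All)
open import Data.List.Relation.Unary.Any using (Any)
open import Data.List.Relation.Unary.AllPairs using (AllPairs)
open import Data.Product using (Σ; _×_; ∃; ∃-syntax; _,_)
open import Data.Sum using (_⊎_)
open import Function.Bundles using (_↔_)
open import Relation.Nullary using (¬_; Dec; yes; no)
open import Relation.Binary.PropositionalEquality using (_≡_; _≢_)
import Algebra.Structures as AS

-- Finite fields (equality is propositional equality).
-- A finite field with q elements; q is then necessarily a prime power,
-- and every prime power arises (GF(q)), unique up to isomorphism.

record FiniteField : Set₁ where
  field
    Carrier : Set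
    _+_ _*_ : Carrier → Carrier → Carrier
    -_      : Carrier → Carrier
    0# 1#   : Carrier
    isCommutativeRing : AS.IsCommutativeRing {A = Carrier} _≡_ _+_ _*_ -_ 0# 1#
    _⁻¹     : Carrier → Carrier
    0≢1     : 0# ≢ 1#
    inverseʳ : ∀ x → x ≢ 0# → x * (x ⁻¹) ≡ 1#
    _≟_     : (x y : Carrier) → Dec (x ≡ y)
    size    : ℕ
    enum    : Carrier ↔ Fin size

module PGL2 (𝔽 : FiniteField) where
  open FiniteField 𝔽

  q : ℕ
  q = size

  data P1 : Set where
    ∞   : P1
    fin : Carrier → P1

  record Mat : Set where
    constructor mat
    field a b c d : Carrier

  det : Mat → Carrier
  det (mat a b c d) = (a * d) + (- (b * c))

  _·_ : Mat → Mat → Mat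
  mat a b c d · mat a' b' c' d' =
    mat ((a * a') + (b * c')) ((a * b') + (b * d'))
        ((c * a') + (d * c')) ((c * b') + (d * d'))

  -- adjugate: represents the inverse in PGL(2,q)
  adj : Mat → Mat
  adj (mat a b c d) = mat d (- b) (- c) a

  -- elements of PGL(2,q) are represented by invertible matrices;
  -- two represent the same group element iff they act identically on P1
  record G : Set where
    constructor ⟨_,_⟩
    field
      M   : Mat
      inv : det M ≢ 0#
  open G public

  actM : Mat → P1 → P1
  actM (mat a b c d) ∞ with c ≟ 0#
  ... | yes _ = ∞
  ... | no  _ = fin (a * (c ⁻¹))
  actM (mat a b c d) (fin x) with ((c * x) + d) ≟ 0#
  ... | yes _ = ∞
  ... | no  _ = fin (((a * x) + b) * (((c * x) + d) ⁻¹))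

  act : G → P1 → P1
  act g = actM (M g)

  _≈_ : G → G → Set
  g ≈ h = ∀ p → act g p ≡ act h p

  invMul : G → G → Mat
  invMul g h = adj (M g) · M h

  _⁻¹ᴳ : G → Mat
  g ⁻¹ᴳ = adj (M g)

  Subset : Set₁
  Subset = G → Set

  Respects : Subset → Set
  Respects S = ∀ {g h} → g ≈ h → S g → S h

  HasCard : Subset → ℕ → Set
  HasCard S k = ∃[ xs ] (length xs ≡ k × All S xs
                        × AllPairs (λ x y → ¬ (x ≈ y)) xs
                        × (∀ g → S g → Any (λ x → g ≈ x) xs))

  SameLabel : G → G → Set
  SameLabel x y = (x ≈ y) ⊎ (∀ p → actM (x ⁻¹ᴳ) p ≡ act y p)

  -- D has exactly k labels {d, d⁻¹}
  HasLabels : Subset → ℕ → Set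
  HasLabels D k = ∃[ xs ] (length xs ≡ k × All D xs
                          × AllPairs (λ x y → ¬ SameLabel x y) xs
                          × (∀ g → D g → Any (λ x → SameLabel g x) xs))

  Der : Subset
  Der g = ∀ p → act g p ≢ p

  InverseClosed : Subset → Set
  InverseClosed S = ∀ g → S g → ∀ h → (∀ p → act h p ≡ actM (g ⁻¹ᴳ) p) → S h

  Dto : P1 → P1 → Subset
  Dto i j d = Der d × act d i ≡ j

  dG≡ : ℕ → Set
  dG≡ n = (∀ i j → i ≢ j → ∀ k → HasLabels (Dto i j) k → n ≤ k)
        × (∃[ i ] ∃[ j ] (i ≢ j × HasLabels (Dto i j) n))

  Adj : Subset → G → G → Set
  Adj S g h = ∀ x → (∀ p → act x p ≡ actM (invMul g h) p) → S x

  Independent : Subset → List G → Set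
  Independent S xs = AllPairs (λ x y → ¬ (x ≈ y) × ¬ Adj S x y) xs

  α≡ : Subset → ℕ → Set
  α≡ S n = (∃[ xs ] (Independent S xs × length xs ≡ n))
         × (∀ xs → Independent S xs → length xs ≤ n)

  DerMinus : Subset → Subset
  DerMinus D g = Der g × ¬ D g

  Univ : Subset
  Univ _ = ⊤

  IsInvClosedDerSubset : Subset → Set
  IsInvClosedDerSubset D = Respects D × InverseClosed D × (∀ g → D g → Der g)

  EKRRobust : Set₁
  EKRRobust = ∀ dG → dG≡ dG → ∀ (D : Subset) → IsInvClosedDerSubset D →
              ∀ k → HasLabels D k → k < dG →
              ∀ n → HasCard Univ n → α≡ (DerMinus D) (n N./ N.suc q)

-- The stabiliser A of ∞ consists of the q(q − 1) affine maps x ↦ αx + β.  Any two of them differ by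
-- a map fixing ∞, so A is independent in Cay(G, S) for every S ⊆ Der(G), and since G is covered by the
-- q + 1 cosets A and t·A (t ∞ = x), this gives independent sets of size |G|/(q + 1).
--
-- For an irreducible monic quadratic X² + eX − b with companion matrix N, the matrices cI + N
-- (c ∈ 𝔽) together with I represent a Singer subgroup of order q + 1: all its non-identity elements
-- are derangements and it is closed under quotients, so it is a clique in Cay(G, Der), and the
-- clique–coclique bound |I|·|C| ≤ |G| bounds α by |G|/(q + 1).  Derangements from Singer subgroups of
-- different quadratics never share a label, and there are (q − 1)q/2 irreducible monic quadratics
-- (q² quadratics minus the q(q + 1)/2 products of unordered pairs of roots).  So if D has fewer labels,
-- some Singer subgroup contains no element of D and is still a clique in Cay(G, Der ∖ D).
--
-- The derangements sending ∞ to 0 are, up to labels, exactly the maps x ↦ b/(x + e) with X² + eX − b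
-- irreducible, one label each; conjugating by an element with ∞ ↦ i and 0 ↦ j (2-transitivity)
-- embeds them label-injectively into every D_{i→j}.  Hence d_G = (q − 1)q/2.

module Submission where

open import Level using (0ℓ)
open import Function.Base using (id; _∘_)
open import Function.Bundles using (Inverse)
open import Data.Empty using (⊥; ⊥-elim)
open import Data.Unit using (tt)
open import Data.Maybe using (Maybe; just; nothing)
open import Data.Product as Product using (Σ; _×_; _,_; proj₁; proj₂; swap)
open import Data.Sum as Sum using (_⊎_; inj₁; inj₂)
open import Data.Nat as ℕ using (ℕ; zero; suc; _≤_; _<_; z≤n; s≤s; _∸_; _/_)
import Data.Nat.Properties as ℕ
open import Data.Nat.DivMod using (m*n/n≡m; /-monoˡ-≤)
open import Data.Nat.Tactic.RingSolver using (solve-∀)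
open import Data.List using (List; []; _∷_; length; map; _++_; filter; cartesianProduct; allFin; take)
open import Data.List.Properties using (length-map; length-++; length-tabulate; length-take; length-removeAt′; filter-all)
open import Data.List.Membership.Propositional using (_∈_; lose)
open import Data.List.Membership.Propositional.Properties
  using ( ∈-map⁺; ∈-map⁻; ∈-++⁻; ∈-++⁺ˡ; ∈-++⁺ʳ; ∈-filter⁺; ∈-filter⁻; ∈-allFin; ∈-length
        ; ∈-cartesianProduct⁺; ∈-cartesianProduct⁻)
open import Data.List.Relation.Unary.All using (All; []; _∷_)
import Data.List.Relation.Unary.All as All
import Data.List.Relation.Unary.All.Properties as All using (map⁺)
open import Data.List.Relation.Unary.Any using (Any; here; there; _─_)
import Data.List.Relation.Unary.Any as Any
open import Data.List.Relation.Unary.AllPairs using (AllPairs; []; _∷_)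
import Data.List.Relation.Unary.AllPairs as AllPairs
import Data.List.Relation.Unary.AllPairs.Properties as AllPairs
open import Data.List.Relation.Unary.Unique.Propositional using (Unique)
import Data.List.Relation.Unary.Unique.Propositional.Properties as Unique
open import Relation.Nullary using (¬_; Dec; yes; no; ¬?)
open import Relation.Unary using (Decidable)
open import Relation.Unary.Properties using (∁?)
open import Relation.Binary.Definitions using (DecidableEquality)
open import Relation.Binary.PropositionalEquality
  using (_≡_; _≢_; refl; sym; trans; cong; cong₂; subst; subst₂; module ≡-Reasoning)
open import Algebra.Bundles using (CommutativeRing; RawRing)
open import Defs

-- The library's ring solvers over an arbitrary commutative ring take coefficients from the ring
-- itself and decide their equality by evaluation, which is stuck on the abstract _≟_ of a field;
-- with coefficients in ℕ × ℕ normalisation computes.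
module IntegerCoefficientSolver {c ℓ} (R : CommutativeRing c ℓ) where
  open CommutativeRing R hiding (refl; sym; trans)
  open CommutativeRing R using () renaming (sym to ≈-sym; trans to ≈-trans; reflexive to ≈-reflexive)
  open import Algebra.Properties.Ring ring using (-0#≈0#; -‿+-comm; -‿involutive; -‿distribˡ-*; -‿distribʳ-*)
  open import Algebra.Properties.CommutativeSemigroup +-commutativeSemigroup using (interchange)
  open import Algebra.Properties.Semiring.Mult.TCOptimised semiring using (×-homo-+; ×1-homo-*) renaming (_×_ to _×′_)
  open import Algebra.Solver.Ring.AlmostCommutativeRing using (_-Raw-AlmostCommutative⟶_; fromCommutativeRing)
  open import Relation.Binary.Reasoning.Setoid setoid

  -- (p , n) stands for the integer p − n.
  ℤ-rawRing : RawRing _ _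
  ℤ-rawRing = record
    { Carrier = ℕ × ℕ ; _≈_ = _≡_
    ; _+_ = λ { (p , n) (p′ , n′) → (p ℕ.+ p′ , n ℕ.+ n′) }
    ; _*_ = λ { (p , n) (p′ , n′) → (p ℕ.* p′ ℕ.+ n ℕ.* n′ , p ℕ.* n′ ℕ.+ n ℕ.* p′) }
    ; -_  = λ { (p , n) → (n , p) }
    ; 0# = (0 , 0) ; 1# = (1 , 0) }

  -- Cancelling common successors makes all representatives of one integer
  -- evaluate to the same term, which the solver's final refl relies on.
  ⟦_⟧ℤ : ℕ × ℕ → Carrier
  ⟦ p     , zero  ⟧ℤ = p ×′ 1#
  ⟦ zero  , suc n ⟧ℤ = - (suc n ×′ 1#)
  ⟦ suc p , suc n ⟧ℤ = ⟦ p , n ⟧ℤ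

  ⟦⟧ℤ-difference : ∀ p n → ⟦ p , n ⟧ℤ ≈ p ×′ 1# + - (n ×′ 1#)
  ⟦⟧ℤ-difference p zero = ≈-sym (≈-trans (+-congˡ -0#≈0#) (+-identityʳ _))
  ⟦⟧ℤ-difference zero (suc n) = ≈-sym (+-identityˡ _)
  ⟦⟧ℤ-difference (suc p) (suc n) = begin
    ⟦ p , n ⟧ℤ                      ≈⟨ ⟦⟧ℤ-difference p n ⟩
    P + - N                         ≈⟨ +-identityˡ _ ⟨
    0# + (P + - N)                  ≈⟨ +-congʳ (-‿inverseʳ 1#) ⟨
    (1# + - 1#) + (P + - N)         ≈⟨ interchange 1# (- 1#) P (- N) ⟩
    (1# + P) + (- 1# + - N)         ≈⟨ +-cong (×-homo-+ 1# 1 p) (≈-sym (-‿+-comm 1# N)) ⟨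
    suc p ×′ 1# + - (1# + N)        ≈⟨ +-congˡ (-‿cong (×-homo-+ 1# 1 n)) ⟨
    suc p ×′ 1# + - (suc n ×′ 1#)   ∎
    where P = p ×′ 1#; N = n ×′ 1#

  morphism : ℤ-rawRing -Raw-AlmostCommutative⟶ fromCommutativeRing R
  morphism = record
    { ⟦_⟧ = ⟦_⟧ℤ ; +-homo = +-homo ; *-homo = *-homo ; -‿homo = -‿homo
    ; 0-homo = ≈-reflexive refl ; 1-homo = ≈-reflexive refl }
    where
    +-homo : ∀ x y → ⟦ RawRing._+_ ℤ-rawRing x y ⟧ℤ ≈ ⟦ x ⟧ℤ + ⟦ y ⟧ℤ
    +-homo (p , n) (p′ , n′) = begin
      ⟦ p ℕ.+ p′ , n ℕ.+ n′ ⟧ℤ                     ≈⟨ ⟦⟧ℤ-difference (p ℕ.+ p′) (n ℕ.+ n′) ⟩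
      (p ℕ.+ p′) ×′ 1# + - ((n ℕ.+ n′) ×′ 1#)       ≈⟨ +-cong (×-homo-+ 1# p p′) (-‿cong (×-homo-+ 1# n n′)) ⟩
      (P + P′) + - (N + N′)                       ≈⟨ +-congˡ (-‿+-comm N N′) ⟨
      (P + P′) + (- N + - N′)                     ≈⟨ interchange P P′ (- N) (- N′) ⟩
      (P + - N) + (P′ + - N′)                     ≈⟨ +-cong (⟦⟧ℤ-difference p n) (⟦⟧ℤ-difference p′ n′) ⟨
      ⟦ p , n ⟧ℤ + ⟦ p′ , n′ ⟧ℤ                   ∎
      where P = p ×′ 1#; N = n ×′ 1#; P′ = p′ ×′ 1#; N′ = n′ ×′ 1#
    *-homo : ∀ x y → ⟦ RawRing._*_ ℤ-rawRing x y ⟧ℤ ≈ ⟦ x ⟧ℤ * ⟦ y ⟧ℤ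
    *-homo (p , n) (p′ , n′) = begin
      ⟦ p ℕ.* p′ ℕ.+ n ℕ.* n′ , p ℕ.* n′ ℕ.+ n ℕ.* p′ ⟧ℤ
        ≈⟨ ⟦⟧ℤ-difference (p ℕ.* p′ ℕ.+ n ℕ.* n′) (p ℕ.* n′ ℕ.+ n ℕ.* p′) ⟩
      (p ℕ.* p′ ℕ.+ n ℕ.* n′) ×′ 1# + - ((p ℕ.* n′ ℕ.+ n ℕ.* p′) ×′ 1#)
        ≈⟨ +-cong (homo-+* p p′ n n′) (-‿cong (homo-+* p n′ n p′)) ⟩
      (P * P′ + N * N′) + - (P * N′ + N * P′)     ≈⟨ +-congˡ (-‿+-comm (P * N′) (N * P′)) ⟨
      (P * P′ + N * N′) + (- (P * N′) + - (N * P′))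
        ≈⟨ interchange (P * P′) (N * N′) (- (P * N′)) (- (N * P′)) ⟩
      (P * P′ + - (P * N′)) + (N * N′ + - (N * P′)) ≈⟨ +-congˡ (+-comm _ _) ⟩
      (P * P′ + - (P * N′)) + (- (N * P′) + N * N′)
        ≈⟨ +-cong (+-congˡ (-‿distribʳ-* P N′)) (+-cong (-‿distribˡ-* N P′) (negated-product N N′)) ⟩
      (P * P′ + P * - N′) + (- N * P′ + - N * - N′) ≈⟨ +-cong (distribˡ P P′ (- N′)) (distribˡ (- N) P′ (- N′)) ⟨
      P * (P′ + - N′) + - N * (P′ + - N′)           ≈⟨ distribʳ _ _ _ ⟨
      (P + - N) * (P′ + - N′)                       ≈⟨ *-cong (⟦⟧ℤ-difference p n) (⟦⟧ℤ-difference p′ n′) ⟨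
      ⟦ p , n ⟧ℤ * ⟦ p′ , n′ ⟧ℤ                     ∎
      where
      P = p ×′ 1#; N = n ×′ 1#; P′ = p′ ×′ 1#; N′ = n′ ×′ 1#
      homo-+* : ∀ a b c d → (a ℕ.* b ℕ.+ c ℕ.* d) ×′ 1# ≈ (a ×′ 1#) * (b ×′ 1#) + (c ×′ 1#) * (d ×′ 1#)
      homo-+* a b c d = ≈-trans (×-homo-+ 1# (a ℕ.* b) (c ℕ.* d)) (+-cong (×1-homo-* a b) (×1-homo-* c d))
      negated-product : ∀ x y → x * y ≈ - x * - y
      negated-product x y = ≈-trans (≈-sym (-‿involutive _)) (≈-trans (-‿cong (-‿distribʳ-* x y)) (-‿distribˡ-* x (- y)))
    -‿homo : ∀ x → ⟦ RawRing.-_ ℤ-rawRing x ⟧ℤ ≈ - ⟦ x ⟧ℤ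
    -‿homo (p , n) = begin
      ⟦ n , p ⟧ℤ          ≈⟨ ⟦⟧ℤ-difference n p ⟩
      N + - P             ≈⟨ +-comm _ _ ⟩
      - P + N             ≈⟨ +-congˡ (-‿involutive N) ⟨
      - P + - - N         ≈⟨ -‿+-comm P (- N) ⟩
      - (P + - N)         ≈⟨ -‿cong (⟦⟧ℤ-difference p n) ⟨
      - ⟦ p , n ⟧ℤ        ∎
      where P = p ×′ 1#; N = n ×′ 1#

  ⟦⟧ℤ-cong : ∀ p n p′ n′ → p ℕ.+ n′ ≡ p′ ℕ.+ n → ⟦ p , n ⟧ℤ ≈ ⟦ p′ , n′ ⟧ℤ
  ⟦⟧ℤ-cong (suc p) (suc n) p′ n′ e = ⟦⟧ℤ-cong p n p′ n′ (ℕ.suc-injective (trans e (ℕ.+-suc p′ n)))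
  ⟦⟧ℤ-cong p n (suc p′) (suc n′) e = ⟦⟧ℤ-cong p n p′ n′ (ℕ.suc-injective (trans (sym (ℕ.+-suc p n′)) e))
  ⟦⟧ℤ-cong p zero p′ zero e = ≈-reflexive (cong (_×′ 1#) (trans (sym (ℕ.+-identityʳ p)) (trans e (ℕ.+-identityʳ p′))))
  ⟦⟧ℤ-cong zero (suc n) zero (suc n′) e = ≈-reflexive (cong (λ k → - (k ×′ 1#)) (sym e))
  ⟦⟧ℤ-cong p zero zero (suc n′) e = ⊥-elim (ℕ.m+1+n≢0 p e)
  ⟦⟧ℤ-cong zero (suc n) p′ zero e = ⊥-elim (ℕ.m+1+n≢0 p′ (sym e))

  _≟ℤ_ : ∀ x y → Maybe (⟦ x ⟧ℤ ≈ ⟦ y ⟧ℤ)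
  (p , n) ≟ℤ (p′ , n′) with p ℕ.+ n′ ℕ.≟ p′ ℕ.+ n
  ... | yes e = just (⟦⟧ℤ-cong p n p′ n′ e)
  ... | no _  = nothing

  open import Algebra.Solver.Ring ℤ-rawRing (fromCommutativeRing R) morphism _≟ℤ_ public
    using (solve; _:=_; _:+_; _:*_; :-_; con; Polynomial)

  :0 :1 : ∀ {n} → Polynomial n
  :0 = con (0 , 0)
  :1 = con (1 , 0)

module _ {A B : Set} (R : A → B → Set) where

  Apart : A → A → Set
  Apart x x′ = ∀ y → R x y → R x′ y → ⊥

  Any-─ : ∀ {x x′ ys} (p : Any (R x) ys) → Apart x x′ → Any (R x′) ys → Any (R x′) (ys ─ p)
  Any-─ (here r) apart (here r′) = ⊥-elim (apart _ r r′)
  Any-─ (here _) _     (there a) = a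
  Any-─ (there _) _    (here r′) = here r′
  Any-─ (there p) apart (there a) = there (Any-─ p apart a)

  pigeonhole : ∀ xs ys → AllPairs Apart xs → All (λ x → Any (R x) ys) xs → length xs ≤ length ys
  pigeonhole [] ys _ _ = z≤n
  pigeonhole (x ∷ xs) ys (apart ∷ aparts) (p ∷ ps) =
    subst (suc (length xs) ≤_) (sym (length-removeAt′ ys (Any.index p)))
      (s≤s (pigeonhole xs (ys ─ p) aparts (All.map (λ (a , q) → Any-─ p a q) (All.zip (apart , ps)))))

module _ {A : Set} where

  AllPairs-∈ : ∀ {R : A → A → Set} xs → AllPairs R xs → AllPairs (λ u v → u ∈ xs × v ∈ xs × R u v) xs
  AllPairs-∈ {R} xs rs = go xs rs id
    where
    go : ∀ ys → AllPairs R ys → (∀ {u} → u ∈ ys → u ∈ xs) → AllPairs (λ u v → u ∈ xs × v ∈ xs × R u v) ys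
    go [] _ _ = []
    go (y ∷ ys) (r ∷ rs) ⊆xs = All.tabulate (λ v∈ys → ⊆xs (here refl) , ⊆xs (there v∈ys) , All.lookup r v∈ys)
                             ∷ go ys rs (⊆xs ∘ there)

  length-filter-∁ : ∀ {P : A → Set} (P? : Decidable P) xs →
                    length (filter P? xs) ℕ.+ length (filter (∁? P?) xs) ≡ length xs
  length-filter-∁ P? [] = refl
  length-filter-∁ P? (x ∷ xs) with P? x
  ... | yes _ = cong suc (length-filter-∁ P? xs)
  ... | no  _ = trans (ℕ.+-suc _ _) (cong suc (length-filter-∁ P? xs))

  length-filter-≢ : (_≟_ : DecidableEquality A) → ∀ {z xs} → Unique xs → z ∈ xs →
                    suc (length (filter (λ x → ¬? (x ≟ z)) xs)) ≡ length xs
  length-filter-≢ _≟_ {z} {y ∷ xs} (y∉xs ∷ _) (here refl) with y ≟ y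
  ... | yes _   = cong (suc ∘ length) (filter-all (λ x → ¬? (x ≟ y)) (All.map (λ y≢x x≡y → y≢x (sym x≡y)) y∉xs))
  ... | no y≢y  = ⊥-elim (y≢y refl)
  length-filter-≢ _≟_ {z} {y ∷ xs} (y∉xs ∷ unique) (there z∈xs) with y ≟ z
  ... | yes refl = ⊥-elim (All.lookup y∉xs z∈xs refl)
  ... | no _     = cong suc (length-filter-≢ _≟_ unique z∈xs)

  ¬¬-All : ∀ {P : A → Set} xs → (∀ {x} → x ∈ xs → ¬ ¬ P x) → ¬ ¬ All P xs
  ¬¬-All [] _ k = k []
  ¬¬-All (x ∷ xs) ¬¬P k = ¬¬P (here refl) λ px → ¬¬-All xs (¬¬P ∘ there) λ pxs → k (px ∷ pxs)

  unorderedPairs : List A → List (A × A)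
  unorderedPairs []       = []
  unorderedPairs (x ∷ xs) = map (x ,_) (x ∷ xs) ++ unorderedPairs xs

  length-unorderedPairs : ∀ xs → 2 ℕ.* length (unorderedPairs xs) ≡ length xs ℕ.* suc (length xs)
  length-unorderedPairs [] = refl
  length-unorderedPairs (x ∷ xs) = begin
    2 ℕ.* length (map (x ,_) (x ∷ xs) ++ unorderedPairs xs)
      ≡⟨ cong (2 ℕ.*_) (trans (length-++ (map (x ,_) (x ∷ xs))) (cong (ℕ._+ length (unorderedPairs xs)) (length-map (x ,_) (x ∷ xs)))) ⟩
    2 ℕ.* (suc n ℕ.+ length (unorderedPairs xs))   ≡⟨ ℕ.*-distribˡ-+ 2 (suc n) _ ⟩
    2 ℕ.* suc n ℕ.+ 2 ℕ.* length (unorderedPairs xs) ≡⟨ cong (2 ℕ.* suc n ℕ.+_) (length-unorderedPairs xs) ⟩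
    2 ℕ.* suc n ℕ.+ n ℕ.* suc n                     ≡⟨ arithmetic n ⟩
    suc n ℕ.* suc (suc n)                            ∎
    where
    open ≡-Reasoning
    n = length xs
    arithmetic : ∀ n → 2 ℕ.* suc n ℕ.+ n ℕ.* suc n ≡ suc n ℕ.* suc (suc n)
    arithmetic = solve-∀

  ∈-unorderedPairs⁻ : ∀ {x y} xs → (x , y) ∈ unorderedPairs xs → x ∈ xs × y ∈ xs
  ∈-unorderedPairs⁻ (z ∷ zs) xy∈ with ∈-++⁻ (map (z ,_) (z ∷ zs)) xy∈
  ... | inj₁ xy∈map with ∈-map⁻ (z ,_) xy∈map
  ...   | _ , y∈ , refl = here refl , y∈
  ∈-unorderedPairs⁻ (z ∷ zs) xy∈ | inj₂ xy∈rest =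
    Product.map there there (∈-unorderedPairs⁻ zs xy∈rest)

  ∈-unorderedPairs⁺ : ∀ {x y xs} → x ∈ xs → y ∈ xs →
                      (x , y) ∈ unorderedPairs xs ⊎ (y , x) ∈ unorderedPairs xs
  ∈-unorderedPairs⁺ {xs = z ∷ zs} (here refl) y∈ = inj₁ (∈-++⁺ˡ (∈-map⁺ (z ,_) y∈))
  ∈-unorderedPairs⁺ {xs = z ∷ zs} (there x∈) (here refl) = inj₂ (∈-++⁺ˡ (∈-map⁺ (z ,_) (there x∈)))
  ∈-unorderedPairs⁺ {xs = z ∷ zs} (there x∈) (there y∈) =
    Sum.map (∈-++⁺ʳ (map (z ,_) (z ∷ zs))) (∈-++⁺ʳ (map (z ,_) (z ∷ zs))) (∈-unorderedPairs⁺ x∈ y∈)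

  unorderedPairs-distinct : ∀ {xs} → Unique xs → AllPairs (λ u v → u ≢ v × u ≢ swap v) (unorderedPairs xs)
  unorderedPairs-distinct {[]} [] = []
  unorderedPairs-distinct {z ∷ zs} (z∉zs ∷ unique) =
    AllPairs.++⁺ (AllPairs.map⁺ (AllPairs.map distinct-seconds (z∉zs ∷ unique)))
                 (unorderedPairs-distinct unique)
                 (All.tabulate λ u∈ → All.tabulate λ v∈ → distinct-across u∈ v∈)
    where
    distinct-seconds : ∀ {y y′} → y ≢ y′ → (z , y) ≢ (z , y′) × (z , y) ≢ (y′ , z)
    distinct-seconds y≢y′ = (λ { refl → y≢y′ refl }) , (λ { refl → y≢y′ refl })
    distinct-across : ∀ {u v} → u ∈ map (z ,_) (z ∷ zs) → v ∈ unorderedPairs zs → u ≢ v × u ≢ swap v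
    distinct-across u∈ v∈ with ∈-map⁻ (z ,_) u∈ | ∈-unorderedPairs⁻ zs v∈
    ... | _ , _ , refl | v₁∈zs , v₂∈zs =
      (λ { refl → All.lookup z∉zs v₁∈zs refl }) , (λ { refl → All.lookup z∉zs v₂∈zs refl })

module _ {A B : Set} where

  length-cartesianProduct : ∀ (xs : List A) (ys : List B) →
                            length (cartesianProduct xs ys) ≡ length xs ℕ.* length ys
  length-cartesianProduct [] ys = refl
  length-cartesianProduct (x ∷ xs) ys = trans (length-++ (map (x ,_) ys))
    (cong₂ ℕ._+_ (length-map (x ,_) ys) (length-cartesianProduct xs ys))

  cartesianProduct-AllPairs : ∀ {P : A → A → Set} {Q : B → B → Set} {xs ys} → AllPairs P xs → AllPairs Q ys →
    AllPairs (λ u v → P (proj₁ u) (proj₁ v) ⊎ (proj₁ u ≡ proj₁ v × Q (proj₂ u) (proj₂ v))) (cartesianProduct xs ys)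
  cartesianProduct-AllPairs {xs = []} [] _ = []
  cartesianProduct-AllPairs {xs = x ∷ xs} {ys} (px ∷ pxs) qys =
    AllPairs.++⁺ (AllPairs.map⁺ (AllPairs.map (λ q → inj₂ (refl , q)) qys))
                 (cartesianProduct-AllPairs pxs qys)
                 (All.tabulate λ u∈ → All.tabulate λ v∈ → across u∈ v∈)
    where
    across : ∀ {u v} → u ∈ map (x ,_) ys → v ∈ cartesianProduct xs ys → _
    across u∈ v∈ with ∈-map⁻ (x ,_) u∈
    ... | _ , _ , refl = inj₁ (All.lookup px (proj₁ (∈-cartesianProduct⁻ xs ys v∈)))

m*n≤o⇒m≤o/n : ∀ m n {o} .{{_ : ℕ.NonZero n}} → m ℕ.* n ≤ o → m ≤ o / n
m*n≤o⇒m≤o/n m n le = subst (_≤ _ / n) (m*n/n≡m m n) (/-monoˡ-≤ n le)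

m≤n*o⇒m/o≤n : ∀ {m} n o .{{_ : ℕ.NonZero o}} → m ≤ n ℕ.* o → m / o ≤ n
m≤n*o⇒m/o≤n n o le = subst (_ / o ≤_) (m*n/n≡m n o) (/-monoˡ-≤ o le)

complement-count : ∀ n r i → r ℕ.+ i ≡ n ℕ.* n → 2 ℕ.* r ≡ n ℕ.* suc n → 2 ℕ.* i ≡ (n ∸ 1) ℕ.* n
complement-count zero r i r+i≡0 _ = cong (2 ℕ.*_) (ℕ.m+n≡0⇒n≡0 r r+i≡0)
complement-count (suc k) r i r+i≡n² 2r≡n[n+1] = ℕ.+-cancelˡ-≡ (suc k ℕ.* suc (suc k)) (2 ℕ.* i) (k ℕ.* suc k) (begin
  suc k ℕ.* suc (suc k) ℕ.+ 2 ℕ.* i   ≡⟨ cong (ℕ._+ 2 ℕ.* i) 2r≡n[n+1] ⟨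
  2 ℕ.* r ℕ.+ 2 ℕ.* i                 ≡⟨ ℕ.*-distribˡ-+ 2 r i ⟨
  2 ℕ.* (r ℕ.+ i)                     ≡⟨ cong (2 ℕ.*_) r+i≡n² ⟩
  2 ℕ.* (suc k ℕ.* suc k)             ≡⟨ arithmetic k ⟩
  suc k ℕ.* suc (suc k) ℕ.+ k ℕ.* suc k ∎)
  where
  open ≡-Reasoning
  arithmetic : ∀ k → 2 ℕ.* (suc k ℕ.* suc k) ≡ suc k ℕ.* suc (suc k) ℕ.+ k ℕ.* suc k
  arithmetic = solve-∀

2*i≡[n∸1]*n⇒0<i : ∀ {n i} → 2 ≤ n → 2 ℕ.* i ≡ (n ∸ 1) ℕ.* n → 0 < i
2*i≡[n∸1]*n⇒0<i {i = zero}  (s≤s (s≤s _)) ()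
2*i≡[n∸1]*n⇒0<i {i = suc i} _ _ = s≤s z≤n

module PGL2Theory (𝔽 : FiniteField) where
  open FiniteField 𝔽 using (Carrier; _⁻¹; _≟_; 0≢1; inverseʳ; enum; isCommutativeRing)
  open PGL2 𝔽

  commutativeRing : CommutativeRing 0ℓ 0ℓ
  commutativeRing = record { isCommutativeRing = isCommutativeRing }

  open CommutativeRing commutativeRing
    using (_+_; _*_; -_; 0#; 1#; +-comm; *-comm; *-assoc; zeroˡ; zeroʳ; +-identityˡ; +-identityʳ; *-identityˡ; *-identityʳ)
  open import Algebra.Properties.Ring (CommutativeRing.ring commutativeRing)
    using (x∙y⁻¹≈ε⇒x≈y; -‿injective; -0#≈0#)
  open IntegerCoefficientSolver commutativeRing using (solve; _:=_; _:+_; _:*_; :-_; :0; :1)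

  F : Set
  F = Carrier

  1≢0 : 1# ≢ 0#
  1≢0 e = 0≢1 (sym e)

  inverseˡ : ∀ x → x ≢ 0# → x ⁻¹ * x ≡ 1#
  inverseˡ x x≢0 = trans (*-comm (x ⁻¹) x) (inverseʳ x x≢0)

  *-cancelˡ : ∀ x → x ≢ 0# → ∀ {y z} → x * y ≡ x * z → y ≡ z
  *-cancelˡ x x≢0 {y} {z} e = begin
    y                  ≡⟨ *-identityˡ y ⟨
    1# * y             ≡⟨ cong (_* y) (inverseˡ x x≢0) ⟨
    (x ⁻¹ * x) * y     ≡⟨ *-assoc _ x y ⟩
    x ⁻¹ * (x * y)     ≡⟨ cong (x ⁻¹ *_) e ⟩
    x ⁻¹ * (x * z)     ≡⟨ *-assoc _ x z ⟨
    (x ⁻¹ * x) * z     ≡⟨ cong (_* z) (inverseˡ x x≢0) ⟩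
    1# * z             ≡⟨ *-identityˡ z ⟩
    z                  ∎
    where open ≡-Reasoning

  *-nonzero : ∀ {x y} → x ≢ 0# → y ≢ 0# → x * y ≢ 0#
  *-nonzero {x} {y} x≢0 y≢0 e = y≢0 (*-cancelˡ x x≢0 (trans e (sym (zeroʳ x))))

  ⁻¹-nonzero : ∀ {x} → x ≢ 0# → x ⁻¹ ≢ 0#
  ⁻¹-nonzero {x} x≢0 e = 1≢0 (trans (sym (inverseʳ x x≢0)) (trans (cong (x *_) e) (zeroʳ x)))

  ⁻¹-unique : ∀ {x y} → x ≢ 0# → x * y ≡ 1# → x ⁻¹ ≡ y
  ⁻¹-unique {x} x≢0 e = *-cancelˡ x x≢0 (trans (inverseʳ x x≢0) (sym e))

  ⁻¹-distrib-* : ∀ {x y} → x ≢ 0# → y ≢ 0# → (x * y) ⁻¹ ≡ x ⁻¹ * y ⁻¹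
  ⁻¹-distrib-* {x} {y} x≢0 y≢0 = ⁻¹-unique (*-nonzero x≢0 y≢0) (begin
    (x * y) * (x ⁻¹ * y ⁻¹)
      ≡⟨ solve 4 (λ x y x′ y′ → (x :* y) :* (x′ :* y′) := (x :* x′) :* (y :* y′)) refl x y (x ⁻¹) (y ⁻¹) ⟩
    (x * x ⁻¹) * (y * y ⁻¹)   ≡⟨ cong₂ _*_ (inverseʳ x x≢0) (inverseʳ y y≢0) ⟩
    1# * 1#                   ≡⟨ *-identityˡ 1# ⟩
    1#                        ∎)
    where open ≡-Reasoning

  1⁻¹≡1 : 1# ⁻¹ ≡ 1#
  1⁻¹≡1 = ⁻¹-unique 1≢0 (*-identityˡ 1#)

  y*x⁻¹*x≡y : ∀ x → x ≢ 0# → ∀ y → (y * x ⁻¹) * x ≡ y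
  y*x⁻¹*x≡y x x≢0 y = trans (*-assoc y _ x) (trans (cong (y *_) (inverseˡ x x≢0)) (*-identityʳ y))

  x*[y*x⁻¹]≡y : ∀ x → x ≢ 0# → ∀ y → x * (y * x ⁻¹) ≡ y
  x*[y*x⁻¹]≡y x x≢0 y = trans (*-comm x _) (y*x⁻¹*x≡y x x≢0 y)

  y*1⁻¹≡y : ∀ y → y * 1# ⁻¹ ≡ y
  y*1⁻¹≡y y = trans (cong (y *_) 1⁻¹≡1) (*-identityʳ y)

  zero-product : ∀ {x y} → x * y ≡ 0# → x ≡ 0# ⊎ y ≡ 0#
  zero-product {x} {y} e with x ≟ 0# | y ≟ 0#
  ... | yes x≡0 | _       = inj₁ x≡0
  ... | no _    | yes y≡0 = inj₂ y≡0
  ... | no x≢0  | no y≢0  = ⊥-elim (*-nonzero x≢0 y≢0 e)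

  -‿nonzero : ∀ {x} → x ≢ 0# → - x ≢ 0#
  -‿nonzero {x} x≢0 e = x≢0 (-‿injective (trans e (sym -0#≈0#)))

  module Enum = Inverse enum

  elements : List F
  elements = map Enum.from (allFin q)

  length-elements : length elements ≡ q
  length-elements = trans (length-map Enum.from (allFin q)) (length-tabulate id)

  ∈-elements : ∀ x → x ∈ elements
  ∈-elements x = subst (_∈ elements) (Enum.strictlyInverseʳ x) (∈-map⁺ Enum.from (∈-allFin (Enum.to x)))

  elements-unique : Unique elements
  elements-unique = Unique.map⁺ from-injective (Unique.allFin⁺ q)
    where
    from-injective : ∀ {i j} → Enum.from i ≡ Enum.from j → i ≡ j
    from-injective {i} {j} e = trans (sym (Enum.strictlyInverseˡ i)) (trans (cong Enum.to e) (Enum.strictlyInverseˡ j))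

  nonzeros : List F
  nonzeros = filter (λ x → ¬? (x ≟ 0#)) elements

  ∈-nonzeros⁺ : ∀ {x} → x ≢ 0# → x ∈ nonzeros
  ∈-nonzeros⁺ x≢0 = ∈-filter⁺ (λ x → ¬? (x ≟ 0#)) (∈-elements _) x≢0

  ∈-nonzeros⁻ : ∀ {x} → x ∈ nonzeros → x ≢ 0#
  ∈-nonzeros⁻ x∈ = proj₂ (∈-filter⁻ (λ x → ¬? (x ≟ 0#)) {xs = elements} x∈)

  nonzeros-unique : Unique nonzeros
  nonzeros-unique = AllPairs.filter⁺ (λ x → ¬? (x ≟ 0#)) elements-unique

  suc-length-nonzeros : suc (length nonzeros) ≡ q
  suc-length-nonzeros = trans (length-filter-≢ _≟_ elements-unique (∈-elements 0#)) length-elements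

  fin-injective : ∀ {x y} → fin x ≡ fin y → x ≡ y
  fin-injective refl = refl

  fin≢∞ : ∀ {x} → fin x ≢ ∞
  fin≢∞ ()

  project : F × F → P1
  project (u , v) with v ≟ 0#
  ... | yes _ = ∞
  ... | no  _ = fin (u * v ⁻¹)

  project-∞ : ∀ {u v} → v ≡ 0# → project (u , v) ≡ ∞
  project-∞ {v = v} v≡0 with v ≟ 0#
  ... | yes _   = refl
  ... | no v≢0  = ⊥-elim (v≢0 v≡0)

  project-fin : ∀ {u v} → v ≢ 0# → project (u , v) ≡ fin (u * v ⁻¹)
  project-fin {v = v} v≢0 with v ≟ 0#
  ... | yes v≡0 = ⊥-elim (v≢0 v≡0)
  ... | no _    = refl

  NonZeroVector : F × F → Set
  NonZeroVector (u , v) = ¬ (u ≡ 0# × v ≡ 0#)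

  project-scale : ∀ {k} → k ≢ 0# → ∀ u v → project (k * u , k * v) ≡ project (u , v)
  project-scale {k} k≢0 u v with v ≟ 0#
  ... | yes v≡0 = project-∞ (trans (cong (k *_) v≡0) (zeroʳ k))
  ... | no v≢0  = trans (project-fin (*-nonzero k≢0 v≢0)) (cong fin (begin
    (k * u) * (k * v) ⁻¹        ≡⟨ cong ((k * u) *_) (⁻¹-distrib-* k≢0 v≢0) ⟩
    (k * u) * (k ⁻¹ * v ⁻¹)
      ≡⟨ solve 4 (λ k u k′ v′ → (k :* u) :* (k′ :* v′) := (k :* k′) :* (u :* v′)) refl k u (k ⁻¹) (v ⁻¹) ⟩
    (k * k ⁻¹) * (u * v ⁻¹)     ≡⟨ cong (_* (u * v ⁻¹)) (inverseʳ k k≢0) ⟩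
    1# * (u * v ⁻¹)             ≡⟨ *-identityˡ _ ⟩
    u * v ⁻¹                    ∎))
    where open ≡-Reasoning

  -- The Möbius action is the action on homogeneous coordinates followed by projection.
  image : Mat → P1 → F × F
  image (mat a b c d) ∞       = (a , c)
  image (mat a b c d) (fin x) = (a * x + b , c * x + d)

  actM-image : ∀ A p → actM A p ≡ project (image A p)
  actM-image (mat a b c d) ∞ with c ≟ 0#
  ... | yes _ = refl
  ... | no  _ = refl
  actM-image (mat a b c d) (fin x) with (c * x + d) ≟ 0#
  ... | yes _ = refl
  ... | no  _ = refl

  actM-∞-zero : ∀ {a b c d} → c ≡ 0# → actM (mat a b c d) ∞ ≡ ∞
  actM-∞-zero {a} {b} {c} {d} c≡0 = trans (actM-image (mat a b c d) ∞) (project-∞ c≡0)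

  actM-∞-nonzero : ∀ {a b c d} → c ≢ 0# → actM (mat a b c d) ∞ ≡ fin (a * c ⁻¹)
  actM-∞-nonzero {a} {b} {c} {d} c≢0 = trans (actM-image (mat a b c d) ∞) (project-fin c≢0)

  actM-∞-unit : ∀ {a b d} → actM (mat a b 1# d) ∞ ≡ fin a
  actM-∞-unit {a} {b} {d} = trans (actM-∞-nonzero {a} {b} {1#} {d} 1≢0) (cong fin (y*1⁻¹≡y a))

  actM-fin-zero : ∀ {a b c d x} → c * x + d ≡ 0# → actM (mat a b c d) (fin x) ≡ ∞
  actM-fin-zero {a} {b} {c} {d} {x} pole = trans (actM-image (mat a b c d) (fin x)) (project-∞ pole)

  actM-fin-nonzero : ∀ {a b c d x} → c * x + d ≢ 0# →
                     actM (mat a b c d) (fin x) ≡ fin ((a * x + b) * (c * x + d) ⁻¹)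
  actM-fin-nonzero {a} {b} {c} {d} {x} regular = trans (actM-image (mat a b c d) (fin x)) (project-fin regular)

  actM-fin-unit : ∀ {a b c d x} → c * x + d ≡ 1# → actM (mat a b c d) (fin x) ≡ fin (a * x + b)
  actM-fin-unit {a} {b} {c} {d} {x} unit = trans (actM-fin-nonzero (λ e → 1≢0 (trans (sym unit) e)))
    (cong fin (trans (cong (λ t → (a * x + b) * t ⁻¹) unit) (y*1⁻¹≡y _)))

  actM-fin-∞ : ∀ {a b c d x} → actM (mat a b c d) (fin x) ≡ ∞ → c * x + d ≡ 0#
  actM-fin-∞ {a} {b} {c} {d} {x} image≡∞ with (c * x + d) ≟ 0#
  ... | yes pole = pole
  ... | no _     = ⊥-elim (fin≢∞ image≡∞)

  actM-fin-fin : ∀ {a b c d x y} → actM (mat a b c d) (fin x) ≡ fin y → a * x + b ≡ y * (c * x + d)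
  actM-fin-fin {a} {b} {c} {d} {x} {y} image≡y with (c * x + d) ≟ 0#
  ... | yes _      = ⊥-elim (fin≢∞ (sym image≡y))
  ... | no regular = trans (sym (y*x⁻¹*x≡y _ regular (a * x + b))) (cong (_* (c * x + d)) (fin-injective image≡y))

  infixr 7 _·ᵥ_
  _·ᵥ_ : Mat → F × F → F × F
  mat a b c d ·ᵥ (u , v) = (a * u + b * v , c * u + d * v)

  project-·ᵥ : ∀ A w → NonZeroVector w → project (A ·ᵥ w) ≡ actM A (project w)
  project-·ᵥ (mat a b c d) (u , v) w≢0 with v ≟ 0#
  ... | yes refl = begin
    project (a * u + b * 0# , c * u + d * 0#) ≡⟨ cong₂ (λ s t → project (s , t)) (lemma a b) (lemma c d) ⟩
    project (u * a , u * c)                   ≡⟨ project-scale (λ u≡0 → w≢0 (u≡0 , refl)) a c ⟩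
    project (a , c)                           ≡⟨ actM-image (mat a b c d) ∞ ⟨
    actM (mat a b c d) ∞                      ∎
    where
    open ≡-Reasoning
    lemma : ∀ s t → s * u + t * 0# ≡ u * s
    lemma s t = solve 3 (λ s t u → s :* u :+ t :* :0 := u :* s) refl s t u
  ... | no v≢0 = begin
    project (a * u + b * v , c * u + d * v)   ≡⟨ cong₂ (λ s t → project (s , t)) (lemma a b) (lemma c d) ⟩
    project (v * (a * x + b) , v * (c * x + d)) ≡⟨ project-scale v≢0 _ _ ⟩
    project (image (mat a b c d) (fin x))     ≡⟨ actM-image (mat a b c d) (fin x) ⟨
    actM (mat a b c d) (fin x)                ∎
    where
    open ≡-Reasoning
    x = u * v ⁻¹
    lemma : ∀ s t → s * u + t * v ≡ v * (s * x + t)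
    lemma s t = begin
      s * u + t * v               ≡⟨ cong (λ u′ → s * u′ + t * v) (x*[y*x⁻¹]≡y v v≢0 u) ⟨
      s * (v * x) + t * v         ≡⟨ solve 4 (λ s t v x → s :* (v :* x) :+ t :* v := v :* (s :* x :+ t)) refl s t v x ⟩
      v * (s * x + t)             ∎

  image-nonzero : ∀ A → det A ≢ 0# → ∀ p → NonZeroVector (image A p)
  image-nonzero (mat a b c d) det≢0 ∞ (refl , refl) =
    det≢0 (solve 2 (λ b d → :0 :* d :+ :- (b :* :0) := :0) refl b d)
  image-nonzero (mat a b c d) det≢0 (fin x) (u≡0 , v≡0) = det≢0 (begin
    a * d + - (b * c)
      ≡⟨ solve 5 (λ a b c d x → a :* d :+ :- (b :* c) := a :* (c :* x :+ d) :+ :- (c :* (a :* x :+ b))) refl a b c d x ⟩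
    a * (c * x + d) + - (c * (a * x + b))             ≡⟨ cong₂ (λ s t → a * s + - (c * t)) v≡0 u≡0 ⟩
    a * 0# + - (c * 0#)                               ≡⟨ solve 2 (λ a c → a :* :0 :+ :- (c :* :0) := :0) refl a c ⟩
    0#                                                ∎)
    where open ≡-Reasoning

  image-· : ∀ A B p → image (A · B) p ≡ A ·ᵥ image B p
  image-· (mat a b c d) (mat a′ b′ c′ d′) ∞ = refl
  image-· (mat a b c d) (mat a′ b′ c′ d′) (fin x) = cong₂ _,_ (lemma a b) (lemma c d)
    where
    lemma : ∀ s t → (s * a′ + t * c′) * x + (s * b′ + t * d′) ≡ s * (a′ * x + b′) + t * (c′ * x + d′)
    lemma s t = solve 7 (λ s t a′ b′ c′ d′ x →
      (s :* a′ :+ t :* c′) :* x :+ (s :* b′ :+ t :* d′) := s :* (a′ :* x :+ b′) :+ t :* (c′ :* x :+ d′))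
      refl s t a′ b′ c′ d′ x

  actM-· : ∀ A B → det B ≢ 0# → ∀ p → actM (A · B) p ≡ actM A (actM B p)
  actM-· A B det≢0 p = begin
    actM (A · B) p                ≡⟨ actM-image (A · B) p ⟩
    project (image (A · B) p)     ≡⟨ cong project (image-· A B p) ⟩
    project (A ·ᵥ image B p)      ≡⟨ project-·ᵥ A (image B p) (image-nonzero B det≢0 p) ⟩
    actM A (project (image B p))  ≡⟨ cong (actM A) (actM-image B p) ⟨
    actM A (actM B p)             ∎
    where open ≡-Reasoning

  infixr 7 _⊙_
  _⊙_ : F → Mat → Mat
  k ⊙ mat a b c d = mat (k * a) (k * b) (k * c) (k * d)

  actM-⊙ : ∀ {k} → k ≢ 0# → ∀ A p → actM (k ⊙ A) p ≡ actM A p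
  actM-⊙ {k} k≢0 A p = begin
    actM (k ⊙ A) p                            ≡⟨ actM-image (k ⊙ A) p ⟩
    project (image (k ⊙ A) p)                 ≡⟨ cong project (image-⊙ A p) ⟩
    project (k * proj₁ (image A p) , k * proj₂ (image A p)) ≡⟨ project-scale k≢0 _ _ ⟩
    project (image A p)                       ≡⟨ actM-image A p ⟨
    actM A p                                  ∎
    where
    open ≡-Reasoning
    lemma : ∀ s t x → (k * s) * x + k * t ≡ k * (s * x + t)
    lemma s t x = solve 4 (λ k s t x → (k :* s) :* x :+ k :* t := k :* (s :* x :+ t)) refl k s t x
    image-⊙ : ∀ A p → image (k ⊙ A) p ≡ (k * proj₁ (image A p) , k * proj₂ (image A p))
    image-⊙ (mat a b c d) ∞ = refl
    image-⊙ (mat a b c d) (fin x) = cong₂ _,_ (lemma a b x) (lemma c d x)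

  I : Mat
  I = mat 1# 0# 0# 1#

  actM-I : ∀ p → actM I p ≡ p
  actM-I ∞ = actM-∞-zero {1#} {0#} {0#} {1#} refl
  actM-I (fin x) = trans (actM-fin-unit {1#} {0#} {0#} {1#} (solve 1 (λ x → :0 :* x :+ :1 := :1) refl x))
                         (cong fin (solve 1 (λ x → :1 :* x :+ :0 := x) refl x))

  mat-cong : ∀ {a b c d a′ b′ c′ d′} → a ≡ a′ → b ≡ b′ → c ≡ c′ → d ≡ d′ → mat a b c d ≡ mat a′ b′ c′ d′
  mat-cong refl refl refl refl = refl

  det-⊙ : ∀ k A → det (k ⊙ A) ≡ (k * k) * det A
  det-⊙ k (mat a b c d) = solve 5 (λ k a b c d →
    (k :* a) :* (k :* d) :+ :- ((k :* b) :* (k :* c)) := (k :* k) :* (a :* d :+ :- (b :* c))) refl k a b c d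

  ·-adj : ∀ A → A · adj A ≡ det A ⊙ I
  ·-adj (mat a b c d) = mat-cong
    (solve 4 (λ a b c d → a :* d :+ b :* (:- c) := (a :* d :+ :- (b :* c)) :* :1) refl a b c d)
    (solve 4 (λ a b c d → a :* (:- b) :+ b :* a := (a :* d :+ :- (b :* c)) :* :0) refl a b c d)
    (solve 4 (λ a b c d → c :* d :+ d :* (:- c) := (a :* d :+ :- (b :* c)) :* :0) refl a b c d)
    (solve 4 (λ a b c d → c :* (:- b) :+ d :* a := (a :* d :+ :- (b :* c)) :* :1) refl a b c d)

  adj-· : ∀ A → adj A · A ≡ det A ⊙ I
  adj-· (mat a b c d) = mat-cong
    (solve 4 (λ a b c d → d :* a :+ (:- b) :* c := (a :* d :+ :- (b :* c)) :* :1) refl a b c d)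
    (solve 4 (λ a b c d → d :* b :+ (:- b) :* d := (a :* d :+ :- (b :* c)) :* :0) refl a b c d)
    (solve 4 (λ a b c d → (:- c) :* a :+ a :* c := (a :* d :+ :- (b :* c)) :* :0) refl a b c d)
    (solve 4 (λ a b c d → (:- c) :* b :+ a :* d := (a :* d :+ :- (b :* c)) :* :1) refl a b c d)

  det-adj : ∀ A → det (adj A) ≡ det A
  det-adj (mat a b c d) = solve 4 (λ a b c d → d :* a :+ :- ((:- b) :* (:- c)) := a :* d :+ :- (b :* c)) refl a b c d

  det-· : ∀ A B → det (A · B) ≡ det A * det B
  det-· (mat a b c d) (mat a′ b′ c′ d′) = solve 8 (λ a b c d a′ b′ c′ d′ →
    (a :* a′ :+ b :* c′) :* (c :* b′ :+ d :* d′) :+ :- ((a :* b′ :+ b :* d′) :* (c :* a′ :+ d :* c′))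
      := (a :* d :+ :- (b :* c)) :* (a′ :* d′ :+ :- (b′ :* c′))) refl a b c d a′ b′ c′ d′

  det-·-nonzero : ∀ A B → det A ≢ 0# → det B ≢ 0# → det (A · B) ≢ 0#
  det-·-nonzero A B detA≢0 detB≢0 e = *-nonzero detA≢0 detB≢0 (trans (sym (det-· A B)) e)

  det-adj-nonzero : ∀ A → det A ≢ 0# → det (adj A) ≢ 0#
  det-adj-nonzero A det≢0 e = det≢0 (trans (sym (det-adj A)) e)

  actM-adjʳ : ∀ A → det A ≢ 0# → ∀ p → actM A (actM (adj A) p) ≡ p
  actM-adjʳ A det≢0 p = begin
    actM A (actM (adj A) p)  ≡⟨ actM-· A (adj A) (det-adj-nonzero A det≢0) p ⟨
    actM (A · adj A) p       ≡⟨ cong (λ B → actM B p) (·-adj A) ⟩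
    actM (det A ⊙ I) p       ≡⟨ actM-⊙ det≢0 I p ⟩
    actM I p                 ≡⟨ actM-I p ⟩
    p                        ∎
    where open ≡-Reasoning

  actM-adjˡ : ∀ A → det A ≢ 0# → ∀ p → actM (adj A) (actM A p) ≡ p
  actM-adjˡ A det≢0 p = begin
    actM (adj A) (actM A p)  ≡⟨ actM-· (adj A) A det≢0 p ⟨
    actM (adj A · A) p       ≡⟨ cong (λ B → actM B p) (adj-· A) ⟩
    actM (det A ⊙ I) p       ≡⟨ actM-⊙ det≢0 I p ⟩
    actM I p                 ≡⟨ actM-I p ⟩
    p                        ∎
    where open ≡-Reasoning

  det-I≢0 : det I ≢ 0#
  det-I≢0 e = 1≢0 (trans (sym (solve 0 (:1 :* :1 :+ :- (:0 :* :0) := :1) refl)) e)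

  -- Singular matrices are sent to the junk value I; every use below is on an invertible matrix.
  toG : Mat → G
  toG A with det A ≟ 0#
  ... | yes _    = ⟨ I , det-I≢0 ⟩
  ... | no det≢0 = ⟨ A , det≢0 ⟩

  act-toG : ∀ A → det A ≢ 0# → ∀ p → act (toG A) p ≡ actM A p
  act-toG A det≢0 p with det A ≟ 0#
  ... | yes det≡0 = ⊥-elim (det≢0 det≡0)
  ... | no _      = refl

  identity : G
  identity = toG I

  act-identity : ∀ p → act identity p ≡ p
  act-identity p = trans (act-toG I det-I≢0 p) (actM-I p)

  _∙_ : G → G → G
  g ∙ h = ⟨ M g · M h , det-·-nonzero (M g) (M h) (inv g) (inv h) ⟩

  ginv : G → G
  ginv g = ⟨ adj (M g) , det-adj-nonzero (M g) (inv g) ⟩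

  _\\_ : G → G → G
  g \\ h = ⟨ invMul g h , det-·-nonzero (adj (M g)) (M h) (det-adj-nonzero (M g) (inv g)) (inv h) ⟩

  act⁻¹ : G → P1 → P1
  act⁻¹ g = actM (g ⁻¹ᴳ)

  act-act⁻¹ : ∀ g p → act g (act⁻¹ g p) ≡ p
  act-act⁻¹ g = actM-adjʳ (M g) (inv g)

  act⁻¹-act : ∀ g p → act⁻¹ g (act g p) ≡ p
  act⁻¹-act g = actM-adjˡ (M g) (inv g)

  act⁻¹-toG : ∀ A → det A ≢ 0# → ∀ p → act⁻¹ (toG A) p ≡ actM (adj A) p
  act⁻¹-toG A det≢0 p = begin
    act⁻¹ (toG A) p                               ≡⟨ cong (act⁻¹ (toG A)) (actM-adjʳ A det≢0 p) ⟨
    act⁻¹ (toG A) (actM A (actM (adj A) p))       ≡⟨ cong (act⁻¹ (toG A)) (act-toG A det≢0 (actM (adj A) p)) ⟨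
    act⁻¹ (toG A) (act (toG A) (actM (adj A) p))  ≡⟨ act⁻¹-act (toG A) (actM (adj A) p) ⟩
    actM (adj A) p                                ∎
    where open ≡-Reasoning

  act⁻¹-fixed : ∀ g {p} → act g p ≡ p → act⁻¹ g p ≡ p
  act⁻¹-fixed g {p} fixed = trans (cong (act⁻¹ g) (sym fixed)) (act⁻¹-act g p)

  act⁻¹-injective : ∀ {c c′} → (∀ p → act⁻¹ c p ≡ act⁻¹ c′ p) → c ≈ c′
  act⁻¹-injective {c} {c′} same p = begin
    act c p                         ≡⟨ cong (act c) (act⁻¹-act c′ p) ⟨
    act c (act⁻¹ c′ (act c′ p))     ≡⟨ cong (act c) (same (act c′ p)) ⟨
    act c (act⁻¹ c (act c′ p))      ≡⟨ act-act⁻¹ c (act c′ p) ⟩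
    act c′ p                        ∎
    where open ≡-Reasoning

  act-∙ : ∀ g h p → act (g ∙ h) p ≡ act g (act h p)
  act-∙ g h = actM-· (M g) (M h) (inv h)

  act-\\ : ∀ g h p → act (g \\ h) p ≡ act⁻¹ g (act h p)
  act-\\ g h = actM-· (adj (M g)) (M h) (inv h)

  act-injective : ∀ g {p r} → act g p ≡ act g r → p ≡ r
  act-injective g {p} {r} e = trans (sym (act⁻¹-act g p)) (trans (cong (act⁻¹ g) e) (act⁻¹-act g r))

  -- IsInverse x y is definitionally the second alternative of SameLabel x y.
  IsInverse : G → G → Set
  IsInverse x y = ∀ p → act⁻¹ x p ≡ act y p

  IsInverse⇒act-act : ∀ {x y} → IsInverse x y → ∀ p → act x (act y p) ≡ p
  IsInverse⇒act-act {x} {y} x⁻¹≡y p = trans (cong (act x) (sym (x⁻¹≡y p))) (act-act⁻¹ x p)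

  act-act⇒IsInverse : ∀ {x y} → (∀ p → act x (act y p) ≡ p) → IsInverse x y
  act-act⇒IsInverse {x} {y} xy≡1 p = trans (cong (act⁻¹ x) (sym (xy≡1 p))) (act⁻¹-act x (act y p))

  IsInverse-sym : ∀ {x y} → IsInverse x y → IsInverse y x
  IsInverse-sym {x} {y} x⁻¹≡y = act-act⇒IsInverse {y} {x} λ p →
    act-injective x (IsInverse⇒act-act {x} {y} x⁻¹≡y (act x p))

  SameLabel-sym : ∀ {x y} → SameLabel x y → SameLabel y x
  SameLabel-sym (inj₁ x≈y) = inj₁ (λ p → sym (x≈y p))
  SameLabel-sym {x} {y} (inj₂ x⁻¹≡y) = inj₂ (IsInverse-sym {x} {y} x⁻¹≡y)

  SameLabel-trans : ∀ {x y z} → SameLabel x y → SameLabel y z → SameLabel x z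
  SameLabel-trans (inj₁ x≈y) (inj₁ y≈z) = inj₁ (λ p → trans (x≈y p) (y≈z p))
  SameLabel-trans {x} {y} {z} (inj₁ x≈y) (inj₂ y⁻¹≡z) =
    inj₂ (act-act⇒IsInverse {x} {z} (λ p → trans (x≈y (act z p)) (IsInverse⇒act-act {y} {z} y⁻¹≡z p)))
  SameLabel-trans (inj₂ x⁻¹≡y) (inj₁ y≈z) = inj₂ (λ p → trans (x⁻¹≡y p) (y≈z p))
  SameLabel-trans {x} {y} {z} (inj₂ x⁻¹≡y) (inj₂ y⁻¹≡z) = inj₁ λ p → begin
    act x p                   ≡⟨ cong (act x) (IsInverse⇒act-act {y} {z} y⁻¹≡z p) ⟨
    act x (act y (act z p))   ≡⟨ IsInverse⇒act-act {x} {y} x⁻¹≡y (act z p) ⟩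
    act z p                   ∎
    where open ≡-Reasoning

  conj : G → G → G
  conj g t = (g ∙ t) ∙ ginv g

  act-conj : ∀ g t r → act (conj g t) (act g r) ≡ act g (act t r)
  act-conj g t r = trans (act-∙ (g ∙ t) (ginv g) (act g r))
    (trans (act-∙ g t (act⁻¹ g (act g r))) (cong (act g ∘ act t) (act⁻¹-act g r)))

  conj-Der : ∀ g {t} → Der t → Der (conj g t)
  conj-Der g {t} derangement p fixed = derangement (act⁻¹ g p) (act-injective g (begin
    act g (act t (act⁻¹ g p))              ≡⟨ act-conj g t (act⁻¹ g p) ⟨
    act (conj g t) (act g (act⁻¹ g p))     ≡⟨ cong (act (conj g t)) (act-act⁻¹ g p) ⟩
    act (conj g t) p                       ≡⟨ fixed ⟩
    p                                      ≡⟨ act-act⁻¹ g p ⟨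
    act g (act⁻¹ g p)                      ∎))
    where open ≡-Reasoning

  conj-SameLabel⁻ : ∀ g {x y} → SameLabel (conj g x) (conj g y) → SameLabel x y
  conj-SameLabel⁻ g {x} {y} (inj₁ same) =
    inj₁ λ r → act-injective g (trans (sym (act-conj g x r)) (trans (same (act g r)) (act-conj g y r)))
  conj-SameLabel⁻ g {x} {y} (inj₂ inverse) = inj₂ (act-act⇒IsInverse {x} {y} λ r → act-injective g (begin
    act g (act x (act y r))                    ≡⟨ act-conj g x (act y r) ⟨
    act (conj g x) (act g (act y r))           ≡⟨ cong (act (conj g x)) (act-conj g y r) ⟨
    act (conj g x) (act (conj g y) (act g r))  ≡⟨ IsInverse⇒act-act {conj g x} {conj g y} inverse (act g r) ⟩
    act g r                                    ∎))
    where open ≡-Reasoning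

  -- The stabiliser of ∞ and the lower bound on α

  affineMat : F × F → Mat
  affineMat (α , β) = mat α β 0# 1#

  affine : F × F → G
  affine u = toG (affineMat u)

  act-affine : ∀ {α} β → α ≢ 0# → ∀ p → act (affine (α , β)) p ≡ actM (affineMat (α , β)) p
  act-affine {α} β α≢0 = act-toG (affineMat (α , β)) (λ e → α≢0 (trans (sym det≡α) e))
    where
    det≡α : det (affineMat (α , β)) ≡ α
    det≡α = solve 2 (λ α β → α :* :1 :+ :- (β :* :0) := α) refl α β

  affine-∞ : ∀ {α} β → α ≢ 0# → act (affine (α , β)) ∞ ≡ ∞
  affine-∞ {α} β α≢0 = trans (act-affine β α≢0 ∞) (actM-∞-zero {α} {β} {0#} {1#} refl)

  affine-fin : ∀ {α} β → α ≢ 0# → ∀ x → act (affine (α , β)) (fin x) ≡ fin (α * x + β)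
  affine-fin β α≢0 x = trans (act-affine β α≢0 (fin x))
    (actM-fin-unit (solve 1 (λ x → :0 :* x :+ :1 := :1) refl x))

  affine-injective : ∀ {α β α′ β′} → α ≢ 0# → α′ ≢ 0# → affine (α , β) ≈ affine (α′ , β′) → (α , β) ≡ (α′ , β′)
  affine-injective {α} {β} {α′} {β′} α≢0 α′≢0 same = cong₂ _,_ α≡α′ β≡β′
    where
    at : ∀ x → α * x + β ≡ α′ * x + β′
    at x = fin-injective (trans (sym (affine-fin β α≢0 x)) (trans (same (fin x)) (affine-fin β′ α′≢0 x)))
    at0 : ∀ α β → α * 0# + β ≡ β
    at0 = solve 2 (λ α β → α :* :0 :+ β := β) refl
    β≡β′ : β ≡ β′
    β≡β′ = trans (sym (at0 α β)) (trans (at 0#) (at0 α′ β′))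
    at1 : ∀ α β → α * 1# + β + - β ≡ α
    at1 = solve 2 (λ α β → α :* :1 :+ β :+ :- β := α) refl
    α≡α′ : α ≡ α′
    α≡α′ = trans (sym (at1 α β)) (trans (cong₂ (λ s t → s + - t) (at 1#) β≡β′) (at1 α′ β′))

  affinePairs : List (F × F)
  affinePairs = cartesianProduct nonzeros elements

  affineGroup : List G
  affineGroup = map affine affinePairs

  -- Any two elements of the stabiliser of ∞ differ by an element fixing ∞, which is no derangement.
  affineGroup-independent : ∀ S → (∀ g → S g → Der g) → Independent S affineGroup
  affineGroup-independent S S⊆Der = AllPairs.map⁺ (AllPairs.map independent
    (AllPairs-∈ affinePairs (Unique.cartesianProduct⁺ nonzeros-unique elements-unique)))
    where
    independent : ∀ {u v} → u ∈ affinePairs × v ∈ affinePairs × u ≢ v →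
                  ¬ (affine u ≈ affine v) × ¬ Adj S (affine u) (affine v)
    independent {α , β} {α′ , β′} (u∈ , v∈ , u≢v) = (λ same → u≢v (affine-injective α≢0 α′≢0 same)) , λ adjacent →
      S⊆Der _ (adjacent (affine (α , β) \\ affine (α′ , β′)) (λ p → refl)) ∞ (begin
        act (affine (α , β) \\ affine (α′ , β′)) ∞        ≡⟨ act-\\ (affine (α , β)) (affine (α′ , β′)) ∞ ⟩
        act⁻¹ (affine (α , β)) (act (affine (α′ , β′)) ∞) ≡⟨ cong (act⁻¹ (affine (α , β))) (affine-∞ β′ α′≢0) ⟩
        act⁻¹ (affine (α , β)) ∞                           ≡⟨ act⁻¹-fixed (affine (α , β)) (affine-∞ β α≢0) ⟩
        ∞                                                  ∎)
      where
      open ≡-Reasoning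
      α≢0 = ∈-nonzeros⁻ (proj₁ (∈-cartesianProduct⁻ nonzeros elements u∈))
      α′≢0 = ∈-nonzeros⁻ (proj₁ (∈-cartesianProduct⁻ nonzeros elements v∈))

  affine-representative : ∀ A → det A ≢ 0# → Mat.c A ≡ 0# →
                          Σ (F × F) λ u → u ∈ affinePairs × (∀ p → actM A p ≡ act (affine u) p)
  affine-representative (mat a b c d) det≢0 refl = u , ∈-cartesianProduct⁺ (∈-nonzeros⁺ α≢0) (∈-elements _) , same
    where
    ad≢0 : a * d ≢ 0#
    ad≢0 e = det≢0 (trans (solve 3 (λ a b d → a :* d :+ :- (b :* :0) := a :* d) refl a b d) e)
    a≢0 : a ≢ 0#
    a≢0 e = ad≢0 (trans (cong (_* d) e) (zeroˡ d))
    d≢0 : d ≢ 0#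
    d≢0 e = ad≢0 (trans (cong (a *_) e) (zeroʳ a))
    α≢0 : a * d ⁻¹ ≢ 0#
    α≢0 = *-nonzero a≢0 (⁻¹-nonzero d≢0)
    u = (a * d ⁻¹ , b * d ⁻¹)
    scaled : mat a b 0# d ≡ d ⊙ affineMat u
    scaled = mat-cong (sym (x*[y*x⁻¹]≡y d d≢0 a)) (sym (x*[y*x⁻¹]≡y d d≢0 b)) (sym (zeroʳ d)) (sym (*-identityʳ d))
    same : ∀ p → actM (mat a b 0# d) p ≡ act (affine u) p
    same p = trans (cong (λ B → actM B p) scaled) (trans (actM-⊙ d≢0 _ p) (sym (act-affine _ α≢0 p)))

  flipMat : F → Mat
  flipMat x = mat x 1# 1# 0#

  det-flipMat-nonzero : ∀ x → det (flipMat x) ≢ 0#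
  det-flipMat-nonzero x e = -‿nonzero 1≢0 (trans (sym (det≡-1 x)) e)
    where
    det≡-1 : ∀ x → x * 0# + - (1# * 1#) ≡ - 1#
    det≡-1 = solve 1 (λ x → x :* :0 :+ :- (:1 :* :1) := :- :1) refl

  flip : F → G
  flip x = toG (flipMat x)

  flipCoset : F × G → G
  flipCoset (x , g) = flip x ∙ g

  -- G is the union of the q + 1 cosets A and flip x · A of the stabiliser A of ∞.
  cosetCover : List G
  cosetCover = affineGroup ++ map flipCoset (cartesianProduct elements affineGroup)

  length-cosetCover : length cosetCover ≡ suc q ℕ.* length affineGroup
  length-cosetCover = trans (length-++ affineGroup) (cong (length affineGroup ℕ.+_)
    (trans (length-map flipCoset (cartesianProduct elements affineGroup))
    (trans (length-cartesianProduct elements affineGroup) (cong (ℕ._* length affineGroup) length-elements))))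

  flip-representative : ∀ {a b c d} → det (mat a b c d) ≢ 0# → c ≢ 0# →
    Σ (F × F) λ u → u ∈ affinePairs × (∀ p → actM (mat a b c d) p ≡ act (flip (a * c ⁻¹) ∙ affine u) p)
  flip-representative {a} {b} {c} {d} det≢0 c≢0 = u , proj₁ (proj₂ representative) , same
    where
    open ≡-Reasoning
    A = mat a b c d
    x = a * c ⁻¹
    B = adj (flipMat x) · A
    det-B≢0 : det B ≢ 0#
    det-B≢0 = det-·-nonzero (adj (flipMat x)) A (det-adj-nonzero (flipMat x) (det-flipMat-nonzero x)) det≢0
    c-B≡0 : Mat.c B ≡ 0#
    c-B≡0 = begin
      - 1# * a + (a * c ⁻¹) * c   ≡⟨ cong (- 1# * a +_) (y*x⁻¹*x≡y c c≢0 a) ⟩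
      - 1# * a + a                ≡⟨ solve 1 (λ a → :- :1 :* a :+ a := :0) refl a ⟩
      0#                          ∎
    representative = affine-representative B det-B≢0 c-B≡0
    u = proj₁ representative
    same : ∀ p → actM A p ≡ act (flip x ∙ affine u) p
    same p = begin
      actM A p                                             ≡⟨ actM-adjʳ (flipMat x) (det-flipMat-nonzero x) (actM A p) ⟨
      actM (flipMat x) (actM (adj (flipMat x)) (actM A p)) ≡⟨ cong (actM (flipMat x)) (actM-· (adj (flipMat x)) A det≢0 p) ⟨
      actM (flipMat x) (actM B p)                          ≡⟨ cong (actM (flipMat x)) (proj₂ (proj₂ representative) p) ⟩
      actM (flipMat x) (act (affine u) p)
        ≡⟨ act-toG (flipMat x) (det-flipMat-nonzero x) (act (affine u) p) ⟨
      act (flip x) (act (affine u) p)                      ≡⟨ act-∙ (flip x) (affine u) p ⟨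
      act (flip x ∙ affine u) p                            ∎

  cosetCover-complete : ∀ g → Any (g ≈_) cosetCover
  cosetCover-complete ⟨ A , det≢0 ⟩ = cover A det≢0 (Mat.c A ≟ 0#)
    where
    cover : ∀ A (det≢0 : det A ≢ 0#) → Dec (Mat.c A ≡ 0#) → Any (⟨ A , det≢0 ⟩ ≈_) cosetCover
    cover A det≢0 (yes c≡0) =
      let (u , u∈ , same) = affine-representative A det≢0 c≡0 in
      lose (∈-++⁺ˡ (∈-map⁺ affine u∈)) same
    cover (mat a b c d) det≢0 (no c≢0) =
      let (u , u∈ , same) = flip-representative det≢0 c≢0 in
      lose (∈-++⁺ʳ affineGroup (∈-map⁺ flipCoset (∈-cartesianProduct⁺ (∈-elements (a * c ⁻¹)) (∈-map⁺ affine u∈)))) same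

  card-G≤ : ∀ n → HasCard Univ n → n ≤ suc q ℕ.* length affineGroup
  card-G≤ n (gs , length≡n , _ , distinct , _) = subst₂ _≤_ length≡n length-cosetCover
    (pigeonhole _≈_ gs cosetCover (AllPairs.map (λ {g} {h} → apart {g} {h}) distinct)
      (All.tabulate λ {g} _ → cosetCover-complete g))
    where
    apart : ∀ {g h} → ¬ (g ≈ h) → Apart _≈_ g h
    apart g≉h k g≈k h≈k = g≉h (λ p → trans (g≈k p) (sym (h≈k p)))

  large-independent-set : ∀ S → (∀ g → S g → Der g) → ∀ n → HasCard Univ n →
                          Σ (List G) λ xs → Independent S xs × length xs ≡ n / suc q
  large-independent-set S S⊆Der n card =
    take (n / suc q) affineGroup ,
    AllPairs.take⁺ (n / suc q) (affineGroup-independent S S⊆Der) ,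
    trans (length-take (n / suc q) affineGroup) (ℕ.m≤n⇒m⊓n≡m n/[q+1]≤|A|)
    where
    n/[q+1]≤|A| : n / suc q ≤ length affineGroup
    n/[q+1]≤|A| = m≤n*o⇒m/o≤n (length affineGroup) (suc q)
      (subst (n ≤_) (ℕ.*-comm (suc q) (length affineGroup)) (card-G≤ n card))

  -- The clique–coclique bound

  -- (x , c) ↦ x c⁻¹ is injective on I × C: if x c⁻¹ = x′ c′⁻¹ with x ≠ x′, then x⁻¹ x′ = c⁻¹ c′
  -- would be an edge between two vertices of the independent set I.
  clique-coclique : ∀ S (I C ys : List G) → Independent S I → AllPairs (λ c d → ¬ c ≈ d) C →
                    (∀ {c d} → c ∈ C → d ∈ C → c ≈ d ⊎ Adj S c d) → (∀ g → Any (g ≈_) ys) →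
                    length I ℕ.* length C ≤ length ys
  clique-coclique S I C ys independent distinct clique covers =
    subst (_≤ length ys) (length-cartesianProduct I C)
      (pigeonhole R (cartesianProduct I C) ys
        (AllPairs.map apart (AllPairs-∈ _ (cartesianProduct-AllPairs independent distinct)))
        (All.tabulate λ {w} _ → covers (proj₁ w ∙ ginv (proj₂ w))))
    where
    R : G × G → G → Set
    R (x , c) y = (x ∙ ginv c) ≈ y
    apart : ∀ {u v} → u ∈ cartesianProduct I C × v ∈ cartesianProduct I C ×
              ((¬ proj₁ u ≈ proj₁ v × ¬ Adj S (proj₁ u) (proj₁ v)) ⊎ (proj₁ u ≡ proj₁ v × ¬ proj₂ u ≈ proj₂ v)) →
            Apart R u v
    apart {x , c} {x′ , c′} (u∈ , v∈ , different) y xc⁻¹≈y x′c′⁻¹≈y = contradiction different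
      where
      same : ∀ p → act x (act⁻¹ c p) ≡ act x′ (act⁻¹ c′ p)
      same p = trans (sym (act-∙ x (ginv c) p)) (trans (xc⁻¹≈y p) (trans (sym (x′c′⁻¹≈y p)) (act-∙ x′ (ginv c′) p)))
      x⁻¹x′≡c⁻¹c′ : ∀ r → act⁻¹ x (act x′ r) ≡ act⁻¹ c (act c′ r)
      x⁻¹x′≡c⁻¹c′ r = begin
        act⁻¹ x (act x′ r)                                ≡⟨ cong (act⁻¹ x ∘ act x′) (act⁻¹-act c′ r) ⟨
        act⁻¹ x (act x′ (act⁻¹ c′ (act c′ r)))            ≡⟨ cong (act⁻¹ x) (same (act c′ r)) ⟨
        act⁻¹ x (act x (act⁻¹ c (act c′ r)))              ≡⟨ act⁻¹-act x (act⁻¹ c (act c′ r)) ⟩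
        act⁻¹ c (act c′ r)                                ∎
        where open ≡-Reasoning
      contradiction : ¬ ((¬ x ≈ x′ × ¬ Adj S x x′) ⊎ (x ≡ x′ × ¬ c ≈ c′))
      contradiction (inj₂ (refl , c≉c′)) = c≉c′ (act⁻¹-injective {c} {c′} λ p → act-injective x (same p))
      contradiction (inj₁ (x≉x′ , not-adjacent)) with clique (proj₂ (∈-cartesianProduct⁻ I C u∈))
                                                             (proj₂ (∈-cartesianProduct⁻ I C v∈))
      ... | inj₁ c≈c′ = x≉x′ λ r → begin
        act x r                          ≡⟨ cong (act x) (act⁻¹-act c r) ⟨
        act x (act⁻¹ c (act c r))        ≡⟨ same (act c r) ⟩
        act x′ (act⁻¹ c′ (act c r))      ≡⟨ cong (act x′) (trans (cong (act⁻¹ c′) (c≈c′ r)) (act⁻¹-act c′ r)) ⟩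
        act x′ r                         ∎
        where open ≡-Reasoning
      ... | inj₂ adjacent = not-adjacent λ z z≡x⁻¹x′ →
        adjacent z λ p → trans (z≡x⁻¹x′ p) (trans (act-\\ x x′ p) (trans (x⁻¹x′≡c⁻¹c′ p) (sym (act-\\ c c′ p))))

  clique⇒α≤ : ∀ S (C : List G) → length C ≡ suc q → AllPairs (λ c d → ¬ c ≈ d) C →
       (∀ {c d} → c ∈ C → d ∈ C → c ≈ d ⊎ Adj S c d) →
       ∀ n → HasCard Univ n → ∀ xs → Independent S xs → length xs ≤ n / suc q
  clique⇒α≤ S C length≡ distinct clique n (gs , length≡n , _ , _ , covers) xs independent =
    m*n≤o⇒m≤o/n (length xs) (suc q) (subst₂ (λ k m → length xs ℕ.* k ≤ m) length≡ length≡n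
      (clique-coclique S xs C gs independent distinct clique λ g → covers g tt))

  -- (b , e) stands for the monic quadratic X² + e X − b.
  Root : F × F → F → Set
  Root (b , e) x = x * (x + e) ≡ b

  HasRoot : F × F → Set
  HasRoot u = Any (Root u) elements

  hasRoot? : ∀ u → Dec (HasRoot u)
  hasRoot? (b , e) = Any.any? (λ x → (x * (x + e)) ≟ b) elements

  quadratics : List (F × F)
  quadratics = cartesianProduct elements elements

  reducibles irreducibles : List (F × F)
  reducibles   = filter hasRoot? quadratics
  irreducibles = filter (∁? hasRoot?) quadratics

  ∈-irreducibles⁺ : ∀ {u} → ¬ HasRoot u → u ∈ irreducibles
  ∈-irreducibles⁺ {b , e} noRoot = ∈-filter⁺ (∁? hasRoot?) (∈-cartesianProduct⁺ (∈-elements b) (∈-elements e)) noRoot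

  ∈-irreducibles⁻ : ∀ {u} → u ∈ irreducibles → ¬ HasRoot u
  ∈-irreducibles⁻ u∈ = proj₂ (∈-filter⁻ (∁? hasRoot?) {xs = quadratics} u∈)

  irreducibles-unique : Unique irreducibles
  irreducibles-unique = AllPairs.filter⁺ (∁? hasRoot?) (Unique.cartesianProduct⁺ elements-unique elements-unique)

  irreducible⇒¬Root : ∀ {u} → ¬ HasRoot u → ∀ x → ¬ Root u x
  irreducible⇒¬Root noRoot x root = noRoot (lose (∈-elements x) root)

  fromRoots : F × F → F × F
  fromRoots (r , s) = (- (r * s) , - (r + s))

  fromRoots-root : ∀ r s → Root (fromRoots (r , s)) r
  fromRoots-root = solve 2 (λ r s → r :* (r :+ :- (r :+ s)) := :- (r :* s)) refl

  fromRoots-swap : ∀ p → fromRoots (swap p) ≡ fromRoots p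
  fromRoots-swap (r , s) = cong₂ _,_ (cong -_ (*-comm s r)) (cong -_ (+-comm s r))

  -- (X − r)(X − s) = (X − r′)(X − s′) evaluated at r gives (r − r′)(r − s′) = 0.
  fromRoots-injective : ∀ p p′ → fromRoots p ≡ fromRoots p′ → p ≡ p′ ⊎ p ≡ swap p′
  fromRoots-injective (r , s) (r′ , s′) same = from-factor (zero-product factors≡0)
    where
    open ≡-Reasoning
    product≡ : r * s ≡ r′ * s′
    product≡ = -‿injective (cong proj₁ same)
    sum≡ : r + s ≡ r′ + s′
    sum≡ = -‿injective (cong proj₂ same)
    factors≡0 : (r + - r′) * (r + - s′) ≡ 0#
    factors≡0 = begin
      (r + - r′) * (r + - s′)
        ≡⟨ solve 3 (λ r r′ s′ → (r :+ :- r′) :* (r :+ :- s′) := r :* (r :+ :- (r′ :+ s′)) :+ r′ :* s′) refl r r′ s′ ⟩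
      r * (r + - (r′ + s′)) + r′ * s′         ≡⟨ cong₂ (λ t u → r * (r + - t) + u) (sym sum≡) (sym product≡) ⟩
      r * (r + - (r + s)) + r * s             ≡⟨ solve 2 (λ r s → r :* (r :+ :- (r :+ s)) :+ r :* s := :0) refl r s ⟩
      0#                                      ∎
    other-root : ∀ {t t′} → r ≡ t → r + s ≡ t + t′ → s ≡ t′
    other-root {t} {t′} refl r+s≡ = begin
      s                ≡⟨ solve 2 (λ r s → (r :+ s) :+ :- r := s) refl r s ⟨
      (r + s) + - r    ≡⟨ cong (_+ - r) r+s≡ ⟩
      (r + t′) + - r   ≡⟨ solve 2 (λ r s → (r :+ s) :+ :- r := s) refl r t′ ⟩
      t′               ∎
    from-factor : r + - r′ ≡ 0# ⊎ r + - s′ ≡ 0# → (r , s) ≡ (r′ , s′) ⊎ (r , s) ≡ (s′ , r′)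
    from-factor (inj₁ r-r′≡0) = let r≡r′ = x∙y⁻¹≈ε⇒x≈y r r′ r-r′≡0 in
      inj₁ (cong₂ _,_ r≡r′ (other-root r≡r′ sum≡))
    from-factor (inj₂ r-s′≡0) = let r≡s′ = x∙y⁻¹≈ε⇒x≈y r s′ r-s′≡0 in
      inj₂ (cong₂ _,_ r≡s′ (other-root r≡s′ (trans sum≡ (+-comm r′ s′))))

  fromRoots-reducible : ∀ p → fromRoots p ∈ reducibles
  fromRoots-reducible (r , s) = ∈-filter⁺ hasRoot? (∈-cartesianProduct⁺ (∈-elements _) (∈-elements _))
    (lose (∈-elements r) (fromRoots-root r s))

  reducible⇒fromRoots : ∀ {u} → u ∈ reducibles → Any (λ p → u ≡ fromRoots p) (unorderedPairs elements)
  reducible⇒fromRoots {b , e} u∈ with Any.satisfied (proj₂ (∈-filter⁻ hasRoot? {xs = quadratics} u∈))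
  ... | x , root = Sum.[ (λ p∈ → lose p∈ u≡) , (λ p∈ → lose p∈ (trans u≡ (sym (fromRoots-swap (x , s))))) ]
                     (∈-unorderedPairs⁺ (∈-elements x) (∈-elements s))
    where
    s = - (x + e)
    u≡ : (b , e) ≡ fromRoots (x , s)
    u≡ = cong₂ _,_
      (trans (sym root) (solve 2 (λ x e → x :* (x :+ e) := :- (x :* :- (x :+ e))) refl x e))
      (solve 2 (λ x e → e := :- (x :+ :- (x :+ e))) refl x e)

  length-reducibles : length reducibles ≡ length (unorderedPairs elements)
  length-reducibles = ℕ.≤-antisym
    (pigeonhole (λ u p → u ≡ fromRoots p) reducibles (unorderedPairs elements)
      (AllPairs.map (λ u≢v p u≡ v≡ → u≢v (trans u≡ (sym v≡)))
        (AllPairs.filter⁺ hasRoot? (Unique.cartesianProduct⁺ elements-unique elements-unique)))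
      (All.tabulate reducible⇒fromRoots))
    (pigeonhole (λ p u → fromRoots p ≡ u) (unorderedPairs elements) reducibles
      (AllPairs.map (λ { {p} {p′} (p≢p′ , p≢swap) u p↦u p′↦u →
          Sum.[ p≢p′ , p≢swap ] (fromRoots-injective p p′ (trans p↦u (sym p′↦u))) })
        (unorderedPairs-distinct elements-unique))
      (All.tabulate λ {p} _ → lose (fromRoots-reducible p) refl))

  twice-length-irreducibles : 2 ℕ.* length irreducibles ≡ (q ∸ 1) ℕ.* q
  twice-length-irreducibles = complement-count q (length reducibles) (length irreducibles)
    (trans (length-filter-∁ hasRoot? quadratics)
      (trans (length-cartesianProduct elements elements) (cong₂ ℕ._*_ length-elements length-elements)))
    (trans (cong (2 ℕ.*_) length-reducibles)
      (trans (length-unorderedPairs elements) (cong (λ n → n ℕ.* suc n) length-elements)))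

  length-irreducibles : (q ∸ 1) ℕ.* q / 2 ≡ length irreducibles
  length-irreducibles = trans (cong (_/ 2) (trans (sym twice-length-irreducibles) (ℕ.*-comm 2 (length irreducibles))))
                              (m*n/n≡m (length irreducibles) 2)

  irreducibles-nonempty : 0 < length irreducibles
  irreducibles-nonempty = 2*i≡[n∸1]*n⇒0<i 2≤q twice-length-irreducibles
    where
    2≤q : 2 ≤ q
    2≤q = subst (2 ≤_) suc-length-nonzeros (s≤s (∈-length (∈-nonzeros⁺ 1≢0)))

  -- Singer subgroups and the upper bound on α

  -- c I + N for the companion matrix N = (0 b ; 1 e) of X² + e X − b.  For irreducible u these q
  -- matrices and I represent the Singer subgroup 𝔽_{q²}^× / 𝔽_q^× of order q + 1.
  singerMat : F × F → F → Mat
  singerMat (b , e) c = mat c b 1# (e + c)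

  singer : F × F → F → G
  singer u c = toG (singerMat u c)

  det-singerMat-nonzero : ∀ {u} → ¬ HasRoot u → ∀ c → det (singerMat u c) ≢ 0#
  det-singerMat-nonzero {b , e} noRoot c det≡0 = irreducible⇒¬Root noRoot c (begin
    c * (c + e)                     ≡⟨ solve 3 (λ b e c → c :* (c :+ e) := (c :* (e :+ c) :+ :- (b :* :1)) :+ b) refl b e c ⟩
    (c * (e + c) + - (b * 1#)) + b  ≡⟨ cong (_+ b) det≡0 ⟩
    0# + b                          ≡⟨ +-identityˡ b ⟩
    b                               ∎)
    where open ≡-Reasoning

  act-singer : ∀ {u} → ¬ HasRoot u → ∀ c p → act (singer u c) p ≡ actM (singerMat u c) p
  act-singer noRoot c = act-toG _ (det-singerMat-nonzero noRoot c)

  actM-singerMat-∞ : ∀ u c → actM (singerMat u c) ∞ ≡ fin c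
  actM-singerMat-∞ (b , e) c = actM-∞-unit {c} {b} {e + c}

  singer-∞ : ∀ {u} → ¬ HasRoot u → ∀ c → act (singer u c) ∞ ≡ fin c
  singer-∞ {u} noRoot c = trans (act-singer noRoot c ∞) (actM-singerMat-∞ u c)

  singerMat-fixed⇒Root : ∀ u c x → actM (singerMat u c) (fin x) ≡ fin x → Root u x
  singerMat-fixed⇒Root (b , e) c x fixed = begin
    x * (x + e)
      ≡⟨ solve 3 (λ e c x → x :* (x :+ e) := x :* (:1 :* x :+ (e :+ c)) :+ :- (c :* x)) refl e c x ⟩
    x * (1# * x + (e + c)) + - (c * x)   ≡⟨ cong (_+ - (c * x)) (actM-fin-fin {c} {b} {1#} {e + c} fixed) ⟨
    (c * x + b) + - (c * x)              ≡⟨ solve 3 (λ b c x → (c :* x :+ b) :+ :- (c :* x) := b) refl b c x ⟩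
    b                                    ∎
    where open ≡-Reasoning

  -- A root x of u is a fixed point unless it is the pole, and at the pole det = (c − x)(x + e + c) = 0.
  Root⇒singerMat-fixed : ∀ u c x → det (singerMat u c) ≢ 0# → Root u x → actM (singerMat u c) (fin x) ≡ fin x
  Root⇒singerMat-fixed (b , e) c x det≢0 refl = trans (actM-fin-nonzero {c} {x * (x + e)} {1#} {e + c} regular)
    (cong fin (begin
      (c * x + x * (x + e)) * D ⁻¹
        ≡⟨ cong (_* D ⁻¹) (solve 3 (λ e c x → c :* x :+ x :* (x :+ e) := x :* (:1 :* x :+ (e :+ c))) refl e c x) ⟩
      (x * D) * D ⁻¹                  ≡⟨ *-assoc x D (D ⁻¹) ⟩
      x * (D * D ⁻¹)                  ≡⟨ cong (x *_) (inverseʳ D regular) ⟩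
      x * 1#                          ≡⟨ *-identityʳ x ⟩
      x                               ∎))
    where
    open ≡-Reasoning
    D = 1# * x + (e + c)
    regular : D ≢ 0#
    regular D≡0 = det≢0 (begin
      c * (e + c) + - (x * (x + e) * 1#)
        ≡⟨ solve 3 (λ e c x → c :* (e :+ c) :+ :- (x :* (x :+ e) :* :1) := (c :+ :- x) :* (:1 :* x :+ (e :+ c))) refl e c x ⟩
      (c + - x) * D                       ≡⟨ cong ((c + - x) *_) D≡0 ⟩
      (c + - x) * 0#                      ≡⟨ zeroʳ _ ⟩
      0#                                  ∎)

  singerMat-derangement : ∀ {u} → ¬ HasRoot u → ∀ c p → actM (singerMat u c) p ≢ p
  singerMat-derangement {u} noRoot c ∞ fixed = fin≢∞ (trans (sym (actM-singerMat-∞ u c)) fixed)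
  singerMat-derangement {u} noRoot c (fin x) fixed = irreducible⇒¬Root noRoot x (singerMat-fixed⇒Root u c x fixed)

  singer-Der : ∀ {u} → ¬ HasRoot u → ∀ c → Der (singer u c)
  singer-Der noRoot c p fixed = singerMat-derangement noRoot c p (trans (sym (act-singer noRoot c p)) fixed)

  singerMat-injective : ∀ u v c c′ → (∀ p → actM (singerMat u c) p ≡ actM (singerMat v c′) p) → u ≡ v × c ≡ c′
  singerMat-injective (b , e) (b′ , e′) c c′ same = cong₂ _,_ b≡b′ e≡e′ , c≡c′
    where
    open ≡-Reasoning
    c≡c′ : c ≡ c′
    c≡c′ = fin-injective (trans (sym (actM-singerMat-∞ (b , e) c)) (trans (same ∞) (actM-singerMat-∞ (b′ , e′) c′)))
    pole-cancels : ∀ s t → 1# * (- s) + t + s ≡ t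
    pole-cancels = solve 2 (λ s t → :1 :* (:- s) :+ t :+ s := t) refl
    -- both matrices have their pole at −(e + c)
    e+c≡e′+c′ : e + c ≡ e′ + c′
    e+c≡e′+c′ = begin
      e + c                               ≡⟨ +-identityˡ (e + c) ⟨
      0# + (e + c)                        ≡⟨ cong (_+ (e + c)) pole′ ⟨
      1# * (- (e + c)) + (e′ + c′) + (e + c) ≡⟨ pole-cancels (e + c) (e′ + c′) ⟩
      e′ + c′                             ∎
      where
      pole′ : 1# * (- (e + c)) + (e′ + c′) ≡ 0#
      pole′ = actM-fin-∞ {c′} {b′} {1#} {e′ + c′} (trans (sym (same (fin (- (e + c)))))
                (actM-fin-zero {c} {b} {1#} {e + c} (solve 1 (λ s → :1 :* (:- s) :+ s := :0) refl (e + c))))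
    e≡e′ : e ≡ e′
    e≡e′ = trans (sym (plus-minus e c)) (trans (cong₂ (λ s t → s + - t) e+c≡e′+c′ c≡c′) (plus-minus e′ c′))
      where
      plus-minus : ∀ e c → (e + c) + - c ≡ e
      plus-minus = solve 2 (λ e c → (e :+ c) :+ :- c := e) refl
    -- at x = 1 − (e + c) both denominators are 1
    x = 1# + - (e + c)
    unit : ∀ t → 1# * (1# + - t) + t ≡ 1#
    unit = solve 1 (λ t → :1 :* (:1 :+ :- t) :+ t := :1) refl
    values : c * x + b ≡ c′ * x + b′
    values = fin-injective (begin
      fin (c * x + b)                  ≡⟨ actM-fin-unit {c} {b} {1#} {e + c} (unit (e + c)) ⟨
      actM (mat c b 1# (e + c)) (fin x) ≡⟨ same (fin x) ⟩
      actM (mat c′ b′ 1# (e′ + c′)) (fin x)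
        ≡⟨ actM-fin-unit {c′} {b′} {1#} {e′ + c′} (trans (cong (λ t → 1# * x + t) (sym e+c≡e′+c′)) (unit (e + c))) ⟩
      fin (c′ * x + b′)                ∎)
    b≡b′ : b ≡ b′
    b≡b′ = trans (sym (cancel c b)) (trans (cong₂ (λ s t → s + - (t * x)) values c≡c′) (cancel c′ b′))
      where
      cancel : ∀ c b → (c * x + b) + - (c * x) ≡ b
      cancel c b = solve 3 (λ c b x → (c :* x :+ b) :+ :- (c :* x) := b) refl c b x

  singer-injective : ∀ {u v} → ¬ HasRoot u → ¬ HasRoot v → ∀ c c′ → singer u c ≈ singer v c′ → u ≡ v × c ≡ c′
  singer-injective {u} {v} noRoot-u noRoot-v c c′ same = singerMat-injective u v c c′ λ p →
    trans (sym (act-singer noRoot-u c p)) (trans (same p) (act-singer noRoot-v c′ p))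

  act⁻¹-singer : ∀ {u} → ¬ HasRoot u → ∀ c p → act⁻¹ (singer u c) p ≡ act (singer u (- (proj₂ u + c))) p
  act⁻¹-singer {b , e} noRoot c p = begin
    act⁻¹ (singer (b , e) c) p                    ≡⟨ act⁻¹-toG (singerMat (b , e) c) (det-singerMat-nonzero noRoot c) p ⟩
    actM (adj (singerMat (b , e) c)) p             ≡⟨ cong (λ A → actM A p) adj≡ ⟩
    actM (- 1# ⊙ singerMat (b , e) (- (e + c))) p  ≡⟨ actM-⊙ (-‿nonzero 1≢0) _ p ⟩
    actM (singerMat (b , e) (- (e + c))) p         ≡⟨ act-singer noRoot (- (e + c)) p ⟨
    act (singer (b , e) (- (e + c))) p             ∎
    where
    open ≡-Reasoning
    adj≡ : adj (singerMat (b , e) c) ≡ - 1# ⊙ singerMat (b , e) (- (e + c))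
    adj≡ = mat-cong
      (solve 2 (λ e c → e :+ c := :- :1 :* :- (e :+ c)) refl e c)
      (solve 1 (λ b → :- b := :- :1 :* b) refl b)
      (solve 0 (:- :1 := :- :1 :* :1) refl)
      (solve 2 (λ e c → c := :- :1 :* (e :+ :- (e :+ c))) refl e c)

  -- I and N span the field 𝔽[N] ≅ 𝔽_{q²}, so a quotient of two matrices c I + N is again one up to a scalar.
  singer-quotient : ∀ {u} → ¬ HasRoot u → ∀ {c c′} → c ≢ c′ →
                    Σ F λ c″ → ∀ p → act (singer u c \\ singer u c′) p ≡ act (singer u c″) p
  singer-quotient {b , e} noRoot {c} {c′} c≢c′ = c″ , λ p → begin
    act (singer u c \\ singer u c′) p                      ≡⟨ act-\\ (singer u c) (singer u c′) p ⟩
    act⁻¹ (singer u c) (act (singer u c′) p)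
      ≡⟨ act⁻¹-toG (singerMat u c) (det-singerMat-nonzero noRoot c) (act (singer u c′) p) ⟩
    actM (adj (singerMat u c)) (act (singer u c′) p)       ≡⟨ cong (actM (adj (singerMat u c))) (act-singer noRoot c′ p) ⟩
    actM (adj (singerMat u c)) (actM (singerMat u c′) p)
      ≡⟨ actM-· (adj (singerMat u c)) (singerMat u c′) (det-singerMat-nonzero noRoot c′) p ⟨
    actM (adj (singerMat u c) · singerMat u c′) p          ≡⟨ cong (λ A → actM A p) product≡ ⟩
    actM (k ⊙ singerMat u c″) p                            ≡⟨ actM-⊙ k≢0 _ p ⟩
    actM (singerMat u c″) p                                ≡⟨ act-singer noRoot c″ p ⟨
    act (singer u c″) p                                    ∎
    where
    open ≡-Reasoning
    u = (b , e)
    k = c + - c′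
    k≢0 : k ≢ 0#
    k≢0 k≡0 = c≢c′ (x∙y⁻¹≈ε⇒x≈y c c′ k≡0)
    c″ = ((e + c) * c′ + - b) * k ⁻¹
    kc″≡ : k * c″ ≡ (e + c) * c′ + - b
    kc″≡ = x*[y*x⁻¹]≡y k k≢0 _
    product≡ : adj (singerMat u c) · singerMat u c′ ≡ k ⊙ singerMat u c″
    product≡ = mat-cong
      (trans (solve 4 (λ b e c c′ → (e :+ c) :* c′ :+ (:- b) :* :1 := (e :+ c) :* c′ :+ :- b) refl b e c c′) (sym kc″≡))
      (solve 4 (λ b e c c′ → (e :+ c) :* b :+ (:- b) :* (e :+ c′) := (c :+ :- c′) :* b) refl b e c c′)
      (solve 2 (λ c c′ → (:- :1) :* c′ :+ c :* :1 := (c :+ :- c′) :* :1) refl c c′)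
      (begin
        (- 1#) * b + c * (e + c′)
          ≡⟨ solve 4 (λ b e c c′ → (:- :1) :* b :+ c :* (e :+ c′) := (c :+ :- c′) :* e :+ ((e :+ c) :* c′ :+ :- b)) refl b e c c′ ⟩
        k * e + ((e + c) * c′ + - b)          ≡⟨ cong (k * e +_) kc″≡ ⟨
        k * e + k * c″                        ≡⟨ solve 3 (λ k e c″ → k :* e :+ k :* c″ := k :* (e :+ c″)) refl k e c″ ⟩
        k * (e + c″)                          ∎)

  singer-SameLabel⇒≡ : ∀ {u v} → ¬ HasRoot u → ¬ HasRoot v → ∀ c c′ → SameLabel (singer u c) (singer v c′) → u ≡ v
  singer-SameLabel⇒≡ noRoot-u noRoot-v c c′ (inj₁ same) = proj₁ (singer-injective noRoot-u noRoot-v c c′ same)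
  singer-SameLabel⇒≡ {u} noRoot-u noRoot-v c c′ (inj₂ inverse) =
    proj₁ (singer-injective noRoot-u noRoot-v _ c′ λ p → trans (sym (act⁻¹-singer noRoot-u c p)) (inverse p))

  irreducibles≤labels : (h : G → G) → (∀ {x y} → SameLabel (h x) (h y) → SameLabel x y) → ∀ ds →
                        All (λ u → Σ F λ c → Any (SameLabel (h (singer u c))) ds) irreducibles →
                        length irreducibles ≤ length ds
  irreducibles≤labels h reflects ds labelled = pigeonhole R irreducibles ds
    (AllPairs.map apart (AllPairs-∈ irreducibles irreducibles-unique))
    (All.map (λ (c , d∈) → Any.map (c ,_) d∈) labelled)
    where
    R : F × F → G → Set
    R u d = Σ F λ c → SameLabel (h (singer u c)) d
    apart : ∀ {u v} → u ∈ irreducibles × v ∈ irreducibles × u ≢ v → Apart R u v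
    apart {u} {v} (u∈ , v∈ , u≢v) d (c , label-u) (c′ , label-v) = u≢v (singer-SameLabel⇒≡
      (∈-irreducibles⁻ u∈) (∈-irreducibles⁻ v∈) c c′
      (reflects {singer u c} {singer v c′}
        (SameLabel-trans {h (singer u c)} {d} {h (singer v c′)} label-u (SameLabel-sym {h (singer v c′)} {d} label-v))))

  singerSubgroup : F × F → List G
  singerSubgroup u = identity ∷ map (singer u) elements

  length-singerSubgroup : ∀ u → length (singerSubgroup u) ≡ suc q
  length-singerSubgroup u = cong suc (trans (length-map (singer u) elements) length-elements)

  singerSubgroup-distinct : ∀ {u} → ¬ HasRoot u → AllPairs (λ g h → ¬ g ≈ h) (singerSubgroup u)
  singerSubgroup-distinct {u} noRoot =
    All.tabulate (λ g∈ → identity≉ (∈-map⁻ (singer u) g∈))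
    ∷ AllPairs.map⁺ (AllPairs.map (λ c≢c′ same → c≢c′ (proj₂ (singer-injective noRoot noRoot _ _ same))) elements-unique)
    where
    identity≉ : ∀ {g} → Σ F (λ c → c ∈ elements × g ≡ singer u c) → ¬ identity ≈ g
    identity≉ (c , _ , refl) same = singer-Der noRoot c ∞ (trans (sym (same ∞)) (act-identity ∞))

  singerSubgroup-quotient : ∀ {u} → ¬ HasRoot u → ∀ {x y} → x ∈ singerSubgroup u → y ∈ singerSubgroup u →
                            x ≈ y ⊎ Σ F λ c → ∀ p → act (x \\ y) p ≡ act (singer u c) p
  singerSubgroup-quotient noRoot (here refl) (here refl) = inj₁ λ _ → refl
  singerSubgroup-quotient {u} noRoot (here refl) (there y∈) with ∈-map⁻ (singer u) y∈
  ... | c , _ , refl = inj₂ (c , λ p → trans (act-\\ identity (singer u c) p) (act⁻¹-fixed identity (act-identity _)))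
  singerSubgroup-quotient {u} noRoot (there x∈) (here refl) with ∈-map⁻ (singer u) x∈
  ... | c , _ , refl = inj₂ (_ , λ p → begin
    act (singer u c \\ identity) p          ≡⟨ act-\\ (singer u c) identity p ⟩
    act⁻¹ (singer u c) (act identity p)     ≡⟨ cong (act⁻¹ (singer u c)) (act-identity p) ⟩
    act⁻¹ (singer u c) p                    ≡⟨ act⁻¹-singer noRoot c p ⟩
    act (singer u (- (proj₂ u + c))) p      ∎)
    where open ≡-Reasoning
  singerSubgroup-quotient {u} noRoot (there x∈) (there y∈) with ∈-map⁻ (singer u) x∈ | ∈-map⁻ (singer u) y∈
  ... | c , _ , refl | c′ , _ , refl with c ≟ c′
  ...   | yes refl = inj₁ λ _ → refl
  ...   | no c≢c′  = inj₂ (singer-quotient noRoot c≢c′)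

  singerSubgroup-clique : ∀ S {u} → ¬ HasRoot u → (∀ c z → (∀ p → act z p ≡ act (singer u c) p) → S z) →
                          ∀ {x y} → x ∈ singerSubgroup u → y ∈ singerSubgroup u → x ≈ y ⊎ Adj S x y
  singerSubgroup-clique S noRoot S⊇singer x∈ y∈ with singerSubgroup-quotient noRoot x∈ y∈
  ... | inj₁ x≈y = inj₁ x≈y
  ... | inj₂ (c , quotient) = inj₂ λ z z≡ → S⊇singer c z λ p → trans (z≡ p) (quotient p)

  -- D is an arbitrary predicate, so a Singer subgroup missed by D is only found under ¬¬;
  -- deciding the bound first turns that into a proof.
  α-robust≤ : ∀ D → Respects D → ∀ k → HasLabels D k → k < length irreducibles →
              ∀ n → HasCard Univ n → ∀ xs → Independent (DerMinus D) xs → length xs ≤ n / suc q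
  α-robust≤ D respects k (ds , length≡k , _ , _ , covers) k<I n card xs independent with length xs ℕ.≤? n / suc q
  ... | yes bounded = bounded
  ... | no unbounded = ⊥-elim (¬¬-All irreducibles meets-D λ hits →
    ℕ.<⇒≱ k<I (subst (length irreducibles ≤_) length≡k (irreducibles≤labels id id ds
      (All.map (λ (c , Dc) → c , covers (singer _ c) Dc) hits))))
    where
    -- a Singer subgroup avoided by D would be a clique of size q + 1 in Cay(G, Der ∖ D)
    meets-D : ∀ {u} → u ∈ irreducibles → ¬ ¬ Σ F λ c → D (singer u c)
    meets-D {u} u∈ avoided = unbounded (clique⇒α≤ (DerMinus D) (singerSubgroup u) (length-singerSubgroup u)
      (singerSubgroup-distinct noRoot)
      (singerSubgroup-clique (DerMinus D) noRoot λ c z z≡ →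
        (λ p fixed → singer-Der noRoot c p (trans (sym (z≡ p)) fixed)) ,
        (λ Dz → avoided (c , respects z≡ Dz)))
      n card xs independent)
      where noRoot = ∈-irreducibles⁻ u∈

  α-Der≤ : ∀ n → HasCard Univ n → ∀ xs → Independent Der xs → length xs ≤ n / suc q
  α-Der≤ n card xs independent = α-robust≤ (λ _ → ⊥) (λ _ ()) 0 ([] , refl , [] , [] , λ _ ()) irreducibles-nonempty
    n card xs (AllPairs.map (λ (x≉y , not-adjacent) → x≉y , λ adjacent → not-adjacent λ z z≡ → proj₁ (adjacent z z≡)) independent)

  -- The minimal number of labels d_G

  -- D_{∞→0} consists, up to labels, of x ↦ b / (x + e) for the irreducible X² + e X − b.
  D∞0 : List G
  D∞0 = map (λ u → singer u 0#) irreducibles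

  D∞0-complete : ∀ g → Dto ∞ (fin 0#) g → Any (SameLabel g) D∞0
  D∞0-complete ⟨ mat a b c d , det≢0 ⟩ (derangement , ∞↦0) with c ≟ 0#
  ... | yes _  = ⊥-elim (fin≢∞ (sym ∞↦0))
  ... | no c≢0 = lose (∈-map⁺ (λ u → singer u 0#) (∈-irreducibles⁺ noRoot)) (inj₁ g≈singer)
    where
    a≡0 : a ≡ 0#
    a≡0 = trans (sym (y*x⁻¹*x≡y c c≢0 a))
      (trans (cong (_* c) (fin-injective ∞↦0)) (zeroˡ c))
    u = (b * c ⁻¹ , d * c ⁻¹)
    scaled : mat a b c d ≡ c ⊙ singerMat u 0#
    scaled = mat-cong (trans a≡0 (sym (zeroʳ c))) (sym (x*[y*x⁻¹]≡y c c≢0 b)) (sym (*-identityʳ c))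
      (sym (trans (cong (c *_) (+-identityʳ _)) (x*[y*x⁻¹]≡y c c≢0 d)))
    same : ∀ p → actM (mat a b c d) p ≡ actM (singerMat u 0#) p
    same p = trans (cong (λ A → actM A p) scaled) (actM-⊙ c≢0 _ p)
    det≢0′ : det (singerMat u 0#) ≢ 0#
    det≢0′ det≡0 = det≢0 (trans (cong det scaled) (trans (det-⊙ c _) (trans (cong ((c * c) *_) det≡0) (zeroʳ _))))
    noRoot : ¬ HasRoot u
    noRoot has-root = let (x , root) = Any.satisfied has-root in
      derangement (fin x) (trans (same (fin x)) (Root⇒singerMat-fixed u 0# x det≢0′ root))
    g≈singer : ⟨ mat a b c d , det≢0 ⟩ ≈ singer u 0#
    g≈singer p = trans (same p) (sym (act-singer noRoot 0# p))

  labels-D∞0 : HasLabels (Dto ∞ (fin 0#)) (length irreducibles)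
  labels-D∞0 = D∞0 , length-map _ irreducibles , sound , distinct , D∞0-complete
    where
    sound : All (Dto ∞ (fin 0#)) D∞0
    sound = All.map⁺ (All.tabulate λ u∈ → let noRoot = ∈-irreducibles⁻ u∈ in singer-Der noRoot 0# , singer-∞ noRoot 0#)
    distinct : AllPairs (λ x y → ¬ SameLabel x y) D∞0
    distinct = AllPairs.map⁺ (AllPairs.map (λ (u∈ , v∈ , u≢v) same-label →
        u≢v (singer-SameLabel⇒≡ (∈-irreducibles⁻ u∈) (∈-irreducibles⁻ v∈) 0# 0# same-label))
      (AllPairs-∈ irreducibles irreducibles-unique))

  two-transitive : ∀ i j → i ≢ j → Σ G λ g → act g ∞ ≡ i × act g (fin 0#) ≡ j
  two-transitive ∞ ∞ ∞≢∞ = ⊥-elim (∞≢∞ refl)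
  two-transitive ∞ (fin y) _ = affine (1# , y) , affine-∞ y 1≢0 ,
    trans (affine-fin y 1≢0 0#) (cong fin (solve 1 (λ y → :1 :* :0 :+ y := y) refl y))
  two-transitive (fin x) ∞ _ = flip x ,
    trans (act-toG (flipMat x) (det-flipMat-nonzero x) ∞) (actM-∞-unit {x} {1#} {0#}) ,
    trans (act-toG (flipMat x) (det-flipMat-nonzero x) (fin 0#))
          (actM-fin-zero {x} {1#} {1#} {0#} (solve 0 (:1 :* :0 :+ :0 := :0) refl))
  two-transitive (fin x) (fin y) x≢y = toG A ,
    trans (act-toG A det≢0 ∞) (actM-∞-unit {x} {y} {1#}) ,
    trans (act-toG A det≢0 (fin 0#)) (trans (actM-fin-unit (solve 0 (:1 :* :0 :+ :1 := :1) refl))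
      (cong fin (solve 2 (λ x y → x :* :0 :+ y := y) refl x y)))
    where
    A = mat x y 1# 1#
    det≢0 : det A ≢ 0#
    det≢0 det≡0 = x≢y (cong fin (x∙y⁻¹≈ε⇒x≈y x y
      (trans (solve 2 (λ x y → x :+ :- y := x :* :1 :+ :- (y :* :1)) refl x y) det≡0)))

  -- Conjugating by g with g ∞ = i and g 0 = j maps D_{∞→0} label-injectively into D_{i→j}.
  labels-Dto≥ : ∀ i j → i ≢ j → ∀ k → HasLabels (Dto i j) k → length irreducibles ≤ k
  labels-Dto≥ i j i≢j k (ds , length≡k , _ , _ , covers) = subst (length irreducibles ≤_) length≡k
    (irreducibles≤labels (conj g) (λ {x} {y} → conj-SameLabel⁻ g {x} {y}) ds
      (All.tabulate λ {u} u∈ → 0# , covers (conj g (singer u 0#)) (in-Dto u∈)))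
    where
    g = proj₁ (two-transitive i j i≢j)
    in-Dto : ∀ {u} → u ∈ irreducibles → Dto i j (conj g (singer u 0#))
    in-Dto {u} u∈ = conj-Der g {singer u 0#} (singer-Der noRoot 0#) , (begin
      act (conj g (singer u 0#)) i
        ≡⟨ cong (act (conj g (singer u 0#))) (proj₁ (proj₂ (two-transitive i j i≢j))) ⟨
      act (conj g (singer u 0#)) (act g ∞)         ≡⟨ act-conj g (singer u 0#) ∞ ⟩
      act g (act (singer u 0#) ∞)                  ≡⟨ cong (act g) (singer-∞ noRoot 0#) ⟩
      act g (fin 0#)                               ≡⟨ proj₂ (proj₂ (two-transitive i j i≢j)) ⟩
      j                                            ∎)
      where
      open ≡-Reasoning
      noRoot = ∈-irreducibles⁻ u∈

  dG≡irreducibles : dG≡ (length irreducibles)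
  dG≡irreducibles = labels-Dto≥ , ∞ , fin 0# , (λ ()) , labels-D∞0

  dG≡-unique : ∀ {m n} → dG≡ m → dG≡ n → m ≡ n
  dG≡-unique (m≤ , i , j , i≢j , labels-m) (n≤ , i′ , j′ , i′≢j′ , labels-n) =
    ℕ.≤-antisym (m≤ i′ j′ i′≢j′ _ labels-n) (n≤ i j i≢j _ labels-m)

theorem5p2 : (𝔽 : FiniteField) → let open PGL2 𝔽 in
    dG≡ ((q ∸ 1) ℕ.* q / 2)
    × (∀ (D : Subset) → IsInvClosedDerSubset D →
         ∀ k → HasLabels D k → k < (q ∸ 1) ℕ.* q / 2 →
         ∀ n → HasCard Univ n →
         α≡ (DerMinus D) (n / suc q) × α≡ Der (n / suc q))
    × EKRRobust
theorem5p2 𝔽 = dG-value , α-values , robust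
  where
  open PGL2 𝔽
  open PGL2Theory 𝔽
  dG-value : dG≡ ((q ∸ 1) ℕ.* q / 2)
  dG-value = subst dG≡ (sym length-irreducibles) dG≡irreducibles
  α-values : ∀ D → IsInvClosedDerSubset D → ∀ k → HasLabels D k → k < (q ∸ 1) ℕ.* q / 2 →
             ∀ n → HasCard Univ n → α≡ (DerMinus D) (n / suc q) × α≡ Der (n / suc q)
  α-values D (respects , _ , _) k labels k<dG n card =
    (large-independent-set (DerMinus D) (λ _ → proj₁) n card ,
     α-robust≤ D respects k labels (subst (k <_) length-irreducibles k<dG) n card) ,
    (large-independent-set Der (λ _ derangement → derangement) n card , α-Der≤ n card)
  robust : EKRRobust
  robust dG dG-is D isD k labels k<dG n card =
    proj₁ (α-values D isD k labels (subst (k <_) (dG≡-unique dG-is dG-value) k<dG) n card)
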